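{- Let $P$ be a point of $\mathrm{PG}(2,q^3)$ with $P\neq T$, $P\notin m_T$ and $P\notin\mathcal P_{2,q}$. Then $P$ lies in the Fig-block $\mathrm{Fig}(T)$ if and only if the projection of $\mathcal P_{2,q}$ from $P$ onto $m_T$, namely $\{PX\cap m_T:X\in\mathcal P_{2,q}\}$, is a $T$-sls.
   Context: Let $q$ be a prime power, $\mathbb{F}_{q^3}^*=\mathbb{F}_{q^3}\setminus\{0\}$. Points of $\mathrm{PG}(2,q^3)$ have coordinates $(x,y,z)$, lines $[a,b,c]$, incidence iff $ax+by+cz=0$. Let $\phi$ be the collineation $(x,y,z)\mapsto(z^q,x^q,y^q)$ (on lines $[d,e,f]\mapsto[f^q,d^q,e^q]$), whose fixed points form the subplane $\mathcal P_{2,q}=\{(x,x^q,x^{q^2}):x\in\mathbb{F}_{q^3}^*\}$ of order $q$. A point has Type I, II, III according as its $\phi$-orbit is one point, three collinear points, three non-collinear points; a line has Type I, II, III according as its $\phi$-orbit is one line, three concurrent lines, three non-concurrent lines. For a Type III line $\ell$, $\mu(\ell)=\ell^\phi\cap\ell^{\phi^2}$. Let $T=(0,0,1)$ (a Type III point), $T^\phi=(1,0,0)$, $T^{\phi^2}=(0,1,0)$, $m_T=[0,0,1]=T^\phi T^{\phi^2}$. The Fig-block $\mathrm{Fig}(T)$ is the set of Type II points on $m_T$ together with $\{\mu(\ell):\ell\text{ a Type III line through }T\}$. A $T$-sls is one of the sets $\mathcal S_\theta=\{(x\theta,x^q,0):x\in\mathbb{F}_{q^3}^*\}$, $\theta\in\mathbb{F}_{q^3}^*$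 (equivalently, an orbit on $m_T\setminus\{T^\phi,T^{\phi^2}\}$ of the group $\{(x,y,z)\mapsto(tx,t^qy,t^{q^2}z):t\in\mathbb{F}_{q^3}^*\}$; these are the scattered $\mathbb{F}_q$-linear sets of pseudoregulus type on $m_T$ with transversal points $T^\phi,T^{\phi^2}$). -}

module Defs where

open import Level using (Level; _⊔_)
open import Data.Nat as ℕ using (ℕ; zero; suc)
open import Data.Nat.Primality using (Prime)
open import Data.Fin using (Fin)
open import Data.Product using (Σ; ∃; ∃₂; _×_; _,_; proj₁)
open import Data.Sum using (_⊎_)
open import Relation.Nullary using (¬_)
open import Relation.Binary.PropositionalEquality using (_≡_)
open import Algebra.Bundles using (CommutativeRing)

IsPrimePower : ℕ → Set
IsPrimePower q = ∃₂ λ p k → Prime p × 1 ℕ.≤ k × q ≡ p ℕ.^ k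

IsFiniteFieldOfOrder : ∀ {c ℓ} → CommutativeRing c ℓ → ℕ → Set (c ⊔ ℓ)
IsFiniteFieldOfOrder R n =
  ¬ (0# ≈ 1#)
  × (∀ x → ¬ (x ≈ 0#) → ∃ λ y → x * y ≈ 1#)
  × Σ (Fin n → Carrier) (λ f → (∀ i j → f i ≈ f j → i ≡ j) × (∀ x → ∃ λ i → f i ≈ x))
  where open CommutativeRing R

-- The plane PG(2, F) over the field F = R (in the theorem F = F_{q^3}),
-- with the collineation φ built from the Frobenius x ↦ x^q.
module Plane {c ℓ} (R : CommutativeRing c ℓ) (q : ℕ) where
  open CommutativeRing R renaming (Carrier to F)

  pow : F → ℕ → F
  pow x zero    = 1#
  pow x (suc n) = x * pow x n

  fr : F → F
  fr x = pow x q

  Triple : Set c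
  Triple = F × F × F

  NonZeroTriple : Triple → Set ℓ
  NonZeroTriple (x , y , z) = ¬ (x ≈ 0# × y ≈ 0# × z ≈ 0#)

  Point : Set (c ⊔ ℓ)
  Point = Σ Triple NonZeroTriple

  Line : Set (c ⊔ ℓ)
  Line = Σ Triple NonZeroTriple

  -- equality in PG(2,F): proportional coordinate triples
  _∼_ : Triple → Triple → Set (c ⊔ ℓ)
  (x , y , z) ∼ (x' , y' , z') =
    ∃ λ t → ¬ (t ≈ 0#) × x ≈ t * x' × y ≈ t * y' × z ≈ t * z'

  Inc : Triple → Triple → Set ℓ
  Inc (x , y , z) (a , b , d) = a * x + b * y + d * z ≈ 0#

  det : Triple → Triple → Triple → F
  det (a , b , d) (e , f , g) (h , i , j) =
    a * (f * j - g * i) - b * (e * j - g * h) + d * (e * i - f * h)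

  φ : Triple → Triple
  φ (x , y , z) = (fr z , fr x , fr y)

  φL : Triple → Triple
  φL (d , e , f) = (fr f , fr d , fr e)

  -- Type II point: orbit of three distinct collinear points
  -- (φ^3 = id, so P ≠ P^φ means the orbit has three distinct points)
  TypeIIPoint : Triple → Set (c ⊔ ℓ)
  TypeIIPoint u = ¬ (u ∼ φ u) × det u (φ u) (φ (φ u)) ≈ 0#

  TypeIIILine : Triple → Set ℓ
  TypeIIILine l = ¬ (det l (φL l) (φL (φL l)) ≈ 0#)

  T : Triple
  T = (0# , 0# , 1#)

  mT : Triple
  mT = (0# , 0# , 1#)

  OnmT : Triple → Set ℓ
  OnmT u = Inc u mT

  InSubplane : Triple → Set (c ⊔ ℓ)
  InSubplane u = ∃ λ x → ¬ (x ≈ 0#) × u ∼ (x , fr x , fr (fr x))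

  -- Fig(T): Type II points on m_T, together with the points μ(ℓ) = ℓ^φ ∩ ℓ^{φ²}
  -- for ℓ a Type III line through T
  InFig : Triple → Set (c ⊔ ℓ)
  InFig u =
    (OnmT u × TypeIIPoint u)
    ⊎ (∃ λ (l : Line) → TypeIIILine (proj₁ l) × Inc T (proj₁ l)
         × Inc u (φL (proj₁ l)) × Inc u (φL (φL (proj₁ l))))

  -- projection of P_{2,q} from the point p onto m_T:
  -- the points y on m_T collinear with p and some X ∈ P_{2,q}
  -- (for p ∉ m_T and p ∉ P_{2,q} this is exactly {pX ∩ m_T : X ∈ P_{2,q}})
  ProjSet : Triple → Triple → Set (c ⊔ ℓ)
  ProjSet p y = OnmT y × ∃ λ x → ¬ (x ≈ 0#) × det p (x , fr x , fr (fr x)) y ≈ 0#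

  Sθ : F → Triple → Set (c ⊔ ℓ)
  Sθ θ y = ∃ λ x → ¬ (x ≈ 0#) × y ∼ (x * θ , fr x , 0#)

  -- a set A of points (given as a predicate on coordinate triples) is a T-sls:
  -- as a set of points of PG(2,F) it equals some S_θ, θ ≠ 0
  IsTsls : (Triple → Set (c ⊔ ℓ)) → Set (c ⊔ ℓ)
  IsTsls A = ∃ λ θ → ¬ (θ ≈ 0#) ×
    (∀ (Y : Point) → (A (proj₁ Y) → Sθ θ (proj₁ Y)) × (Sθ θ (proj₁ Y) → A (proj₁ Y)))

-- A point P = (p₁, p₂, p₃) with p₃ ≠ 0 projects X = (x, x^q, x^{q²}) onto m_T at (A x, B x, 0), where
-- A x = p₃ x - p₁ x^{q²} and B x = p₃ x^q - p₂ x^{q²}.  Both sides of the equivalence turn out to be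
-- equivalent to the condition  p₃ p₃^q = p₁ p₂^q  and  N p₃ ≠ N p₂  (N the norm to F_q).
-- If P = μ(ℓ) for a Type III line ℓ = [a, b, 0] through T, the two incidences give the first equation and
-- Type III means N a + N b ≠ 0, which yields the second; conversely ℓ = [p₃^{q²}, -p₂^{q²}, 0] works.
-- Under the condition, A x = θ (B x)^q with θ = -p₃ / p₂^q, and B is bijective because N p₃ ≠ N p₂, so the
-- projection is exactly S_θ.  Conversely, if the projection is S_θ then N (A x) = N θ N (B x) for all x and
-- B has no nonzero root; Hilbert 90 turns the latter into N p₃ ≠ N p₂, and for q ≥ 3 comparing two
-- coefficients of the first identity (a polynomial identity of degree < q³) gives p₃ p₃^q = p₁ p₂^q.
-- For q = 2 every nonzero norm is 1, and Hilbert 90 alone gives a contradiction.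

module Submission where

open import Defs
open import Data.Product using (_×_; proj₁)
open import Relation.Nullary using (¬_)
open import Function.Bundles using (_⇔_)
open import Algebra.Bundles using (CommutativeRing)

open import Algebra.Bundles using (RawRing)
open import Data.Empty using (⊥-elim)
open import Data.Fin as Fin using (Fin)
open import Data.Fin.Patterns using (0F; 1F; 2F; 3F; 4F; 5F; 6F)
open import Data.Fin.Permutation using (permutation)
import Data.Fin.Properties as Fin
open import Data.Integer as ℤ using (ℤ; +_; -[1+_]; _⊖_; _◃_; sign; ∣_∣)
import Data.Integer.Properties as ℤ
open import Data.List using (List; []; _∷_; length)
open import Data.List.Relation.Unary.All using (All; []; _∷_)
open import Data.Maybe using (Maybe; just; nothing)
open import Data.Nat as ℕ using (ℕ; zero; suc; _∸_)
import Data.Nat.Properties as ℕ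
open import Data.Nat.Primality using (Prime; euclidsLemma; prime⇒nonTrivial; prime⇒nonZero)
open import Data.Product using (∃; _,_; proj₂)
open import Data.Sign as Sign using (Sign)
open import Data.Sum using (_⊎_; inj₁; inj₂)
open import Function using (_∘_)
open import Function.Bundles using (mk⇔)
open import Function.Consequences.Propositional using (inverseʳ⇒injective; strictlyInverseʳ⇒inverseʳ)
open import Function.Definitions using (Injective)
open import Relation.Binary.Definitions using (Decidable)
open import Relation.Binary.PropositionalEquality as ≡ using (_≡_; _≢_)
open import Relation.Nullary using (yes; no)

module IntegerCoefficients {c ℓ} (R : CommutativeRing c ℓ) where
  open CommutativeRing R
  open import Algebra.Properties.Ring ring
    using (-‿distribˡ-*; -‿involutive; -‿+-comm; -‿anti-homo-+; -0#≈0#; xyx⁻¹≈y)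
  open import Algebra.Properties.CommutativeSemigroup *-commutativeSemigroup using (x∙yz≈y∙xz)
  -- The optimised multiple satisfies 1 · x = x definitionally, so that `con (+ 1)` is 1#.
  open import Algebra.Properties.Semiring.Mult.TCOptimised semiring
    using (×-homo-+; ×1-homo-*; 1+×) renaming (_×_ to _·_)
  open import Algebra.Solver.Ring.AlmostCommutativeRing
    using (AlmostCommutativeRing; fromCommutativeRing; _-Raw-AlmostCommutative⟶_)
  open import Relation.Binary.Reasoning.Setoid setoid

  fromℤ : ℤ → Carrier
  fromℤ (+ n)      = n · 1#
  fromℤ (-[1+ n ]) = - (suc n · 1#)

  -‿homo : ∀ i → fromℤ (ℤ.- i) ≈ - fromℤ i
  -‿homo (+ zero)  = sym -0#≈0#
  -‿homo (+ suc n) = refl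
  -‿homo -[1+ n ]  = sym (-‿involutive _)

  ⊖-homo : ∀ m n → fromℤ (m ⊖ n) ≈ m · 1# - n · 1#
  ⊖-homo m       zero    = sym (trans (+-congˡ -0#≈0#) (+-identityʳ _))
  ⊖-homo zero    (suc n) = sym (+-identityˡ _)
  ⊖-homo (suc m) (suc n) = begin
    fromℤ (suc m ⊖ suc n)    ≡⟨ ≡.cong fromℤ (ℤ.[1+m]⊖[1+n]≡m⊖n m n) ⟩
    fromℤ (m ⊖ n)            ≈⟨ ⊖-homo m n ⟩
    a - b                    ≈⟨ xyx⁻¹≈y 1# (a - b) ⟨
    (1# + (a - b)) - 1#      ≈⟨ +-congʳ (+-assoc _ _ _) ⟨
    ((1# + a) - b) - 1#      ≈⟨ +-assoc _ _ _ ⟩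
    (1# + a) + (- b - 1#)    ≈⟨ +-congˡ (-‿anti-homo-+ 1# b) ⟨
    (1# + a) - (1# + b)      ≈⟨ +-cong (1+× m 1#) (-‿cong (1+× n 1#)) ⟨
    suc m · 1# - suc n · 1#  ∎
    where a = m · 1#; b = n · 1#

  +-homo : ∀ i j → fromℤ (i ℤ.+ j) ≈ fromℤ i + fromℤ j
  +-homo -[1+ m ] -[1+ n ] = begin
    - (suc (suc (m ℕ.+ n)) · 1#)     ≡⟨ ≡.cong (λ k → - (suc k · 1#)) (ℕ.+-suc m n) ⟨
    - ((suc m ℕ.+ suc n) · 1#)       ≈⟨ -‿cong (×-homo-+ 1# (suc m) (suc n)) ⟩
    - (suc m · 1# + suc n · 1#)      ≈⟨ -‿+-comm _ _ ⟨
    - (suc m · 1#) + - (suc n · 1#)  ∎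
  +-homo -[1+ m ] (+ n)    = trans (⊖-homo n (suc m)) (+-comm _ _)
  +-homo (+ m)    -[1+ n ] = ⊖-homo m (suc n)
  +-homo (+ m)    (+ n)    = ×-homo-+ 1# m n

  signed : Sign → Carrier
  signed Sign.+ = 1#
  signed Sign.- = - 1#

  signed-homo : ∀ s t → signed (s Sign.* t) ≈ signed s * signed t
  signed-homo Sign.- Sign.- = sym (begin
    - 1# * - 1#    ≈⟨ -‿distribˡ-* 1# (- 1#) ⟨
    - (1# * - 1#)  ≈⟨ -‿cong (*-identityˡ _) ⟩
    - - 1#         ≈⟨ -‿involutive 1# ⟩
    1#             ∎)
  signed-homo Sign.- Sign.+ = sym (*-identityʳ _)
  signed-homo Sign.+ Sign.- = sym (*-identityˡ _)
  signed-homo Sign.+ Sign.+ = sym (*-identityˡ _)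

  ◃-homo : ∀ s n → fromℤ (s ◃ n) ≈ signed s * (n · 1#)
  ◃-homo Sign.- zero    = sym (zeroʳ _)
  ◃-homo Sign.+ zero    = sym (zeroʳ _)
  ◃-homo Sign.+ (suc n) = sym (*-identityˡ _)
  ◃-homo Sign.- (suc n) = trans (-‿cong (sym (*-identityˡ _))) (-‿distribˡ-* 1# _)

  fromℤ-sign-abs : ∀ i → fromℤ i ≈ signed (sign i) * (∣ i ∣ · 1#)
  fromℤ-sign-abs i = trans (reflexive (≡.cong fromℤ (≡.sym (ℤ.◃-inverse i)))) (◃-homo (sign i) ∣ i ∣)

  *-homo : ∀ i j → fromℤ (i ℤ.* j) ≈ fromℤ i * fromℤ j
  *-homo i j = begin
    fromℤ (i ℤ.* j)                   ≈⟨ ◃-homo (sign i Sign.* sign j) (∣ i ∣ ℕ.* ∣ j ∣) ⟩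
    signed (sign i Sign.* sign j) * ((∣ i ∣ ℕ.* ∣ j ∣) · 1#)
                                      ≈⟨ *-cong (signed-homo (sign i) (sign j)) (×1-homo-* ∣ i ∣ ∣ j ∣) ⟩
    (sᵢ * sⱼ) * (aᵢ * aⱼ)             ≈⟨ *-assoc sᵢ sⱼ _ ⟩
    sᵢ * (sⱼ * (aᵢ * aⱼ))             ≈⟨ *-congˡ (x∙yz≈y∙xz sⱼ aᵢ aⱼ) ⟩
    sᵢ * (aᵢ * (sⱼ * aⱼ))             ≈⟨ *-assoc sᵢ aᵢ _ ⟨
    (sᵢ * aᵢ) * (sⱼ * aⱼ)             ≈⟨ *-cong (fromℤ-sign-abs i) (fromℤ-sign-abs j) ⟨
    fromℤ i * fromℤ j                 ∎
    where
    sᵢ = signed (sign i); sⱼ = signed (sign j); aᵢ = ∣ i ∣ · 1#; aⱼ = ∣ j ∣ · 1#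

  ℤ-rawRing : RawRing _ _
  ℤ-rawRing = record
    { Carrier = ℤ ; _≈_ = _≡_ ; _+_ = ℤ._+_ ; _*_ = ℤ._*_ ; -_ = ℤ.-_ ; 0# = + 0 ; 1# = + 1 }

  almostCommutativeRing : AlmostCommutativeRing c ℓ
  almostCommutativeRing = fromCommutativeRing R

  fromℤ-homomorphism : ℤ-rawRing -Raw-AlmostCommutative⟶ almostCommutativeRing
  fromℤ-homomorphism = record
    { ⟦_⟧ = fromℤ ; +-homo = +-homo ; *-homo = *-homo ; -‿homo = -‿homo ; 0-homo = refl ; 1-homo = refl }

  fromℤ-≟ : ∀ i j → Maybe (fromℤ i ≈ fromℤ j)
  fromℤ-≟ i j with i ℤ.≟ j
  ... | yes i≡j = just (reflexive (≡.cong fromℤ i≡j))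
  ... | no _    = nothing

  open import Algebra.Solver.Ring ℤ-rawRing almostCommutativeRing fromℤ-homomorphism fromℤ-≟ public
    using (solve; _:=_; _:+_; _:*_; _:-_; :-_; _:^_; con)

module _ {p : ℕ} (p-prime : Prime p) where
  open import Data.Nat.Combinatorics using (_C_; k![n∸k]!∣n!)
  open import Data.Nat.Combinatorics.Specification using (nCk≡n!/k![n-k]!)
  open import Data.Nat.DivMod using (m/n*n≡m)
  open import Data.Nat.Divisibility using (_∣_; _∤_; divides; ∣⇒≤)

  prime∤m! : ∀ {m} → m ℕ.< p → p ∤ m ℕ.!
  prime∤m! {zero}  m<p   p∣1  = ℕ.<⇒≱ (ℕ.nonTrivial⇒n>1 p {{prime⇒nonTrivial p-prime}}) (∣⇒≤ p∣1)
  prime∤m! {suc m} 1+m<p p∣m! with euclidsLemma (suc m) (m ℕ.!) p-prime p∣m!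
  ... | inj₁ p∣1+m = ℕ.<⇒≱ 1+m<p (∣⇒≤ p∣1+m)
  ... | inj₂ p∣m!  = prime∤m! (ℕ.<-trans (ℕ.n<1+n m) 1+m<p) p∣m!

  private
    p∣C*k!*[p∸k]! : ∀ {k} → 0 ℕ.< k → k ℕ.< p → p ∣ (p C k) ℕ.* (k ℕ.! ℕ.* (p ∸ k) ℕ.!)
    p∣C*k!*[p∸k]! {k} 0<k k<p = ≡.subst (p ∣_) (≡.sym C*k!*[p∸k]!≡p!) (n∣n! (ℕ.<-trans 0<k k<p))
      where
      instance _ = k ℕ.!* (p ∸ k) !≢0
      n∣n! : ∀ {n} → 0 ℕ.< n → n ∣ n ℕ.!
      n∣n! {suc n} _ = divides (n ℕ.!) (ℕ.*-comm (suc n) (n ℕ.!))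
      C*k!*[p∸k]!≡p! : (p C k) ℕ.* (k ℕ.! ℕ.* (p ∸ k) ℕ.!) ≡ p ℕ.!
      C*k!*[p∸k]!≡p! = ≡.trans (≡.cong (ℕ._* (k ℕ.! ℕ.* (p ∸ k) ℕ.!)) (nCk≡n!/k![n-k]! (ℕ.<⇒≤ k<p)))
                               (m/n*n≡m (k![n∸k]!∣n! (ℕ.<⇒≤ k<p)))

  prime∣C : ∀ {k} → 0 ℕ.< k → k ℕ.< p → p ∣ p C k
  prime∣C {k} 0<k k<p with euclidsLemma (p C k) (k ℕ.! ℕ.* (p ∸ k) ℕ.!) p-prime (p∣C*k!*[p∸k]! 0<k k<p)
  ... | inj₁ p∣C          = p∣C
  ... | inj₂ p∣k!*[p∸k]! with euclidsLemma (k ℕ.!) ((p ∸ k) ℕ.!) p-prime p∣k!*[p∸k]!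
  ... | inj₁ p∣k!         = ⊥-elim (prime∤m! k<p p∣k!)
  ... | inj₂ p∣[p∸k]!     = ⊥-elim (prime∤m! (ℕ.∸-monoʳ-< 0<k (ℕ.<⇒≤ k<p)) p∣[p∸k]!)

primePower⇒2≤ : ∀ {q} → IsPrimePower q → 2 ℕ.≤ q
primePower⇒2≤ {q} (p , k , p-prime , 1≤k , q≡p^k) = begin
  2          ≤⟨ ℕ.nonTrivial⇒n>1 p {{prime⇒nonTrivial p-prime}} ⟩
  p          ≡⟨ ℕ.^-identityʳ p ⟨
  p ℕ.^ 1    ≤⟨ ℕ.^-monoʳ-≤ p {{prime⇒nonZero p-prime}} 1≤k ⟩
  p ℕ.^ k    ≡⟨ q≡p^k ⟨
  q          ∎
  where open ℕ.≤-Reasoning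

digit+q*-injective : ∀ {q i i′ m m′} → i ℕ.< q → i′ ℕ.< q →
                     i ℕ.+ q ℕ.* m ≡ i′ ℕ.+ q ℕ.* m′ → i ≡ i′ × m ≡ m′
digit+q*-injective {suc q} {i} {i′} {m} {m′} i<q i′<q eq = i≡i′ , ℕ.*-cancelˡ-≡ m m′ (suc q) (ℕ.+-cancelˡ-≡ i _ _ eq′)
  where
  open import Data.Nat.DivMod using (_%_; [m+kn]%n≡m%n; m<n⇒m%n≡m)
  [i+qm]%q≡i : ∀ {i} m → i ℕ.< suc q → (i ℕ.+ suc q ℕ.* m) % suc q ≡ i
  [i+qm]%q≡i {i} m i<q = ≡.trans (≡.cong (λ k → (i ℕ.+ k) % suc q) (ℕ.*-comm (suc q) m))
                                  (≡.trans ([m+kn]%n≡m%n i m (suc q)) (m<n⇒m%n≡m i<q))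
  i≡i′ : i ≡ i′
  i≡i′ = ≡.trans (≡.sym ([i+qm]%q≡i m i<q)) (≡.trans (≡.cong (_% suc q) eq) ([i+qm]%q≡i m′ i′<q))
  eq′ : i ℕ.+ suc q ℕ.* m ≡ i ℕ.+ suc q ℕ.* m′
  eq′ = ≡.trans eq (≡.cong (ℕ._+ suc q ℕ.* m′) (≡.sym i≡i′))

digit+q*-< : ∀ {q i m M} → i ℕ.< q → m ℕ.< M → i ℕ.+ q ℕ.* m ℕ.< q ℕ.* M
digit+q*-< {q} {i} {m} {M} i<q m<M = begin-strict
  i ℕ.+ q ℕ.* m   <⟨ ℕ.+-monoˡ-< (q ℕ.* m) i<q ⟩
  q ℕ.+ q ℕ.* m   ≡⟨ ℕ.*-suc q m ⟨
  q ℕ.* suc m     ≤⟨ ℕ.*-monoʳ-≤ q m<M ⟩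
  q ℕ.* M         ∎
  where open ℕ.≤-Reasoning

Digits : Set
Digits = ℕ × ℕ × ℕ

DigitsBelow : ℕ → Digits → Set
DigitsBelow q (i , j , k) = i ℕ.< q × j ℕ.< q × k ℕ.< q

fromDigits : ℕ → Digits → ℕ
fromDigits q (i , j , k) = i ℕ.+ q ℕ.* (j ℕ.+ q ℕ.* k)

fromDigits-injective : ∀ {q d d′} → DigitsBelow q d → DigitsBelow q d′ → fromDigits q d ≡ fromDigits q d′ → d ≡ d′
fromDigits-injective (i<q , j<q , k<q) (i′<q , j′<q , k′<q) eq
  with ≡.refl , eq′ ← digit+q*-injective i<q i′<q eq
  with ≡.refl , eq″ ← digit+q*-injective j<q j′<q eq′
  with ≡.refl ← eq″ = ≡.refl

fromDigits-< : ∀ {q d} → DigitsBelow q d → fromDigits q d ℕ.< q ℕ.^ 3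
fromDigits-< {q} (i<q , j<q , k<q) =
  digit+q*-< i<q (digit+q*-< j<q (ℕ.<-≤-trans k<q (ℕ.≤-reflexive (≡.sym (ℕ.*-identityʳ q)))))

module CharacteristicPrime {c ℓ} (R : CommutativeRing c ℓ) {p : ℕ} (p-prime : Prime p) where
  open CommutativeRing R
  open import Algebra.Properties.Semiring.Mult semiring using (×-assoc-*; ×-congʳ; ×1-homo-*) renaming (_×_ to _·_)
  open import Algebra.Properties.Semiring.Exp semiring using (_^_; ^-congˡ; ^-assocʳ)
  open import Algebra.Properties.Semiring.Sum semiring using (sum; sum-cong-≋; sum-init-last; sum-replicate-zero)
  open import Algebra.Properties.CommutativeSemiring.Binomial commutativeSemiring using (theorem; binomialTerm)
  open import Data.Nat.Combinatorics using (_C_; nCn≡1)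
  open import Data.Nat.Divisibility using (_∣_; divides)
  open import Data.Vec.Functional using (init; last)
  open import Relation.Binary.Reasoning.Setoid setoid

  module _ (p·1≈0 : p · 1# ≈ 0#) where

    private
      p∣m⇒m·x≈0 : ∀ {m} → p ∣ m → ∀ x → m · x ≈ 0#
      p∣m⇒m·x≈0 {m} (divides d m≡dp) x = begin
        m · x                 ≈⟨ ×-congʳ m (*-identityˡ x) ⟨
        m · (1# * x)          ≈⟨ ×-assoc-* m 1# x ⟨
        (m · 1#) * x          ≡⟨ ≡.cong (λ k → (k · 1#) * x) m≡dp ⟩
        ((d ℕ.* p) · 1#) * x  ≈⟨ *-congʳ (×1-homo-* d p) ⟩
        (d · 1# * p · 1#) * x ≈⟨ *-congʳ (trans (*-congˡ p·1≈0) (zeroʳ _)) ⟩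
        0# * x                ≈⟨ zeroˡ x ⟩
        0#                    ∎

      binomial-dream : ∀ m .{{_ : ℕ.NonZero m}} x y → (∀ k → 0 ℕ.< k → k ℕ.< m → ∀ z → (m C k) · z ≈ 0#) →
                       (x + y) ^ m ≈ x ^ m + y ^ m
      binomial-dream (suc m) x y middle≈0 = begin
        (x + y) ^ suc m                                ≈⟨ theorem (suc m) x y ⟩
        term Fin.zero + sum (term ∘ Fin.suc)           ≈⟨ +-cong first (sum-init-last (term ∘ Fin.suc)) ⟩
        y ^ suc m + (sum (init (term ∘ Fin.suc)) + last (term ∘ Fin.suc))
                                                       ≈⟨ +-congˡ (+-cong middle final) ⟩
        y ^ suc m + (0# + x ^ suc m)                   ≈⟨ +-congˡ (+-identityˡ _) ⟩
        y ^ suc m + x ^ suc m                          ≈⟨ +-comm _ _ ⟩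
        x ^ suc m + y ^ suc m                          ∎
        where
        term = binomialTerm x y (suc m)
        term-at : ∀ i k → Fin.toℕ i ≡ k → term i ≈ (suc m C k) · (x ^ k * y ^ (suc m ∸ k))
        term-at i k ≡.refl = refl
        first : term Fin.zero ≈ y ^ suc m
        first = trans (+-identityʳ _) (*-identityˡ _)
        final : last (term ∘ Fin.suc) ≈ x ^ suc m
        final = begin
          term (Fin.suc (Fin.fromℕ m))
            ≈⟨ term-at _ (suc m) (≡.cong suc (Fin.toℕ-fromℕ m)) ⟩
          (suc m C suc m) · (x ^ suc m * y ^ (suc m ∸ suc m))
            ≡⟨ ≡.cong₂ (λ a b → a · (x ^ suc m * y ^ b)) (nCn≡1 (suc m)) (ℕ.n∸n≡0 m) ⟩
          x ^ suc m * 1# + 0#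
            ≈⟨ trans (+-identityʳ _) (*-identityʳ _) ⟩
          x ^ suc m
            ∎
        middle : sum (init (term ∘ Fin.suc)) ≈ 0#
        middle = trans (sum-cong-≋ λ i → trans (term-at _ _ (≡.cong suc (Fin.toℕ-inject₁ i)))
                                                 (middle≈0 _ (ℕ.s≤s ℕ.z≤n) (ℕ.s≤s (Fin.toℕ<n i)) _))
                       (sum-replicate-zero m)

    freshman's-dream : ∀ x y → (x + y) ^ p ≈ x ^ p + y ^ p
    freshman's-dream x y =
      binomial-dream p {{prime⇒nonZero p-prime}} x y (λ k 0<k k<p → p∣m⇒m·x≈0 (prime∣C p-prime 0<k k<p))

    freshman's-dream-^ : ∀ j x y → (x + y) ^ (p ℕ.^ j) ≈ x ^ (p ℕ.^ j) + y ^ (p ℕ.^ j)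
    freshman's-dream-^ zero    x y = trans (*-identityʳ _) (sym (+-cong (*-identityʳ x) (*-identityʳ y)))
    freshman's-dream-^ (suc j) x y = begin
      (x + y) ^ (p ℕ.* p ℕ.^ j)               ≈⟨ ^-assocʳ (x + y) p (p ℕ.^ j) ⟨
      ((x + y) ^ p) ^ (p ℕ.^ j)               ≈⟨ ^-congˡ (p ℕ.^ j) (freshman's-dream x y) ⟩
      (x ^ p + y ^ p) ^ (p ℕ.^ j)             ≈⟨ freshman's-dream-^ j (x ^ p) (y ^ p) ⟩
      (x ^ p) ^ (p ℕ.^ j) + (y ^ p) ^ (p ℕ.^ j) ≈⟨ +-cong (^-assocʳ x p (p ℕ.^ j)) (^-assocʳ y p (p ℕ.^ j)) ⟩
      x ^ (p ℕ.* p ℕ.^ j) + y ^ (p ℕ.* p ℕ.^ j) ∎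

module FiniteField {c ℓ} (F : CommutativeRing c ℓ) {n : ℕ} (isFiniteField : IsFiniteFieldOfOrder F n) where
  open CommutativeRing F
  open import Algebra.Properties.Ring ring using (x∙y⁻¹≈ε⇒x≈y)
  open import Algebra.Properties.Semiring.Exp semiring using (_^_)
  open import Relation.Binary.Reasoning.Setoid setoid
  open IntegerCoefficients F

  1≉0 : 1# ≉ 0#
  1≉0 1≈0 = proj₁ isFiniteField (sym 1≈0)

  private
    enum : Fin n → Carrier
    enum = proj₁ (proj₂ (proj₂ isFiniteField))

    enum-injective : ∀ i j → enum i ≈ enum j → i ≡ j
    enum-injective = proj₁ (proj₂ (proj₂ (proj₂ isFiniteField)))

    index : Carrier → Fin n
    index x = proj₁ (proj₂ (proj₂ (proj₂ (proj₂ isFiniteField))) x)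

    enum-index : ∀ x → enum (index x) ≈ x
    enum-index x = proj₂ (proj₂ (proj₂ (proj₂ (proj₂ isFiniteField))) x)

  infix 4 _≟_
  _≟_ : Decidable _≈_
  x ≟ y with index x Fin.≟ index y
  ... | yes eq = yes (trans (sym (enum-index x)) (trans (reflexive (≡.cong enum eq)) (enum-index y)))
  ... | no neq = no (λ x≈y → neq (enum-injective _ _ (trans (enum-index x) (trans x≈y (sym (enum-index y))))))

  -- 0# ⁻¹ is the junk value 0#.
  infix 8 _⁻¹
  _⁻¹ : Carrier → Carrier
  x ⁻¹ with x ≟ 0#
  ... | yes _  = 0#
  ... | no x≉0 = proj₁ (proj₁ (proj₂ isFiniteField) x x≉0)

  x*x⁻¹≈1 : ∀ {x} → x ≉ 0# → x * x ⁻¹ ≈ 1#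
  x*x⁻¹≈1 {x} x≉0 with x ≟ 0#
  ... | yes x≈0 = ⊥-elim (x≉0 x≈0)
  ... | no x≉0′ = proj₂ (proj₁ (proj₂ isFiniteField) x x≉0′)

  x⁻¹*x≈1 : ∀ {x} → x ≉ 0# → x ⁻¹ * x ≈ 1#
  x⁻¹*x≈1 x≉0 = trans (*-comm _ _) (x*x⁻¹≈1 x≉0)

  *-cancelˡ : ∀ {x y z} → x ≉ 0# → x * y ≈ x * z → y ≈ z
  *-cancelˡ {x} {y} {z} x≉0 xy≈xz = begin
    y                ≈⟨ *-identityˡ y ⟨
    1# * y           ≈⟨ *-congʳ (x⁻¹*x≈1 x≉0) ⟨
    (x ⁻¹ * x) * y   ≈⟨ *-assoc _ _ _ ⟩
    x ⁻¹ * (x * y)   ≈⟨ *-congˡ xy≈xz ⟩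
    x ⁻¹ * (x * z)   ≈⟨ *-assoc _ _ _ ⟨
    (x ⁻¹ * x) * z   ≈⟨ *-congʳ (x⁻¹*x≈1 x≉0) ⟩
    1# * z           ≈⟨ *-identityˡ z ⟩
    z                ∎

  x*y≈0⇒y≈0 : ∀ {x y} → x ≉ 0# → x * y ≈ 0# → y ≈ 0#
  x*y≈0⇒y≈0 x≉0 xy≈0 = *-cancelˡ x≉0 (trans xy≈0 (sym (zeroʳ _)))

  x*y≈0⇒x≈0 : ∀ {x y} → y ≉ 0# → x * y ≈ 0# → x ≈ 0#
  x*y≈0⇒x≈0 y≉0 xy≈0 = x*y≈0⇒y≈0 y≉0 (trans (*-comm _ _) xy≈0)

  *-≉0 : ∀ {x y} → x ≉ 0# → y ≉ 0# → x * y ≉ 0#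
  *-≉0 x≉0 y≉0 xy≈0 = y≉0 (x*y≈0⇒y≈0 x≉0 xy≈0)

  x*y≈0⇒x≈0⊎y≈0 : ∀ {x y} → x * y ≈ 0# → x ≈ 0# ⊎ y ≈ 0#
  x*y≈0⇒x≈0⊎y≈0 {x} xy≈0 with x ≟ 0#
  ... | yes x≈0 = inj₁ x≈0
  ... | no x≉0  = inj₂ (x*y≈0⇒y≈0 x≉0 xy≈0)

  x⁻¹≉0 : ∀ {x} → x ≉ 0# → x ⁻¹ ≉ 0#
  x⁻¹≉0 x≉0 x⁻¹≈0 = 1≉0 (trans (sym (x*x⁻¹≈1 x≉0)) (trans (*-congˡ x⁻¹≈0) (zeroʳ _)))

  x*y≈1⇒y≈x⁻¹ : ∀ {x y} → x ≉ 0# → x * y ≈ 1# → y ≈ x ⁻¹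
  x*y≈1⇒y≈x⁻¹ x≉0 xy≈1 = *-cancelˡ x≉0 (trans xy≈1 (sym (x*x⁻¹≈1 x≉0)))

  x*y≈z⇒x≈z*y⁻¹ : ∀ {x y z} → y ≉ 0# → x * y ≈ z → x ≈ z * y ⁻¹
  x*y≈z⇒x≈z*y⁻¹ {x} {y} {z} y≉0 xy≈z = begin
    x                ≈⟨ *-identityʳ x ⟨
    x * 1#           ≈⟨ *-congˡ (x*x⁻¹≈1 y≉0) ⟨
    x * (y * y ⁻¹)   ≈⟨ *-assoc x y _ ⟨
    (x * y) * y ⁻¹   ≈⟨ *-congʳ xy≈z ⟩
    z * y ⁻¹         ∎

  open import Algebra.Properties.Semiring.Sum semiring using (sum)
  import Algebra.Properties.CommutativeMonoid.Sum

  eval : List Carrier → Carrier → Carrier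
  eval []       x = 0#
  eval (a ∷ as) x = a + x * eval as x

  quotient : Carrier → List Carrier → List Carrier
  quotient r []           = []
  quotient r (a ∷ [])     = []
  quotient r (a ∷ b ∷ bs) = eval (b ∷ bs) r ∷ quotient r (b ∷ bs)

  length-quotient : ∀ r {m} ps → length ps ℕ.≤ suc m → length (quotient r ps) ℕ.≤ m
  length-quotient r []                   _           = ℕ.z≤n
  length-quotient r (a ∷ [])             _           = ℕ.z≤n
  length-quotient r {suc m} (a ∷ b ∷ bs) (ℕ.s≤s len) = ℕ.s≤s (length-quotient r (b ∷ bs) len)

  remainder-theorem : ∀ r ps x → eval ps x ≈ (x - r) * eval (quotient r ps) x + eval ps r
  remainder-theorem r []           x =
    solve 2 (λ x r → con (+ 0) := (x :- r) :* con (+ 0) :+ con (+ 0)) refl x r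
  remainder-theorem r (a ∷ [])     x =
    solve 3 (λ a x r → a :+ x :* con (+ 0) := (x :- r) :* con (+ 0) :+ (a :+ r :* con (+ 0))) refl a x r
  remainder-theorem r (a ∷ b ∷ bs) x = begin
    a + x * eval (b ∷ bs) x
      ≈⟨ +-congˡ (*-congˡ (remainder-theorem r (b ∷ bs) x)) ⟩
    a + x * ((x - r) * Q + E)
      ≈⟨ solve 5 (λ a x r Q E → a :+ x :* ((x :- r) :* Q :+ E) := (x :- r) :* (E :+ x :* Q) :+ (a :+ r :* E))
                 refl a x r Q E ⟩
    (x - r) * (E + x * Q) + (a + r * E)
      ∎
    where
    Q = eval (quotient r (b ∷ bs)) x
    E = eval (b ∷ bs) r

  zero-quotient⇒zero : ∀ r ps → All (_≈ 0#) (quotient r ps) → eval ps r ≈ 0# → All (_≈ 0#) ps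
  zero-quotient⇒zero r []           _           _       = []
  zero-quotient⇒zero r (a ∷ [])     _           root = trans (sym (trans (+-congˡ (zeroʳ r)) (+-identityʳ a))) root ∷ []
  zero-quotient⇒zero r (a ∷ b ∷ bs) (E≈0 ∷ Q≈0) root = a≈0 ∷ zero-quotient⇒zero r (b ∷ bs) Q≈0 E≈0
    where
    a≈0 : a ≈ 0#
    a≈0 = begin
      a                         ≈⟨ +-identityʳ a ⟨
      a + 0#                    ≈⟨ +-congˡ (trans (*-congˡ E≈0) (zeroʳ r)) ⟨
      a + r * eval (b ∷ bs) r   ≈⟨ root ⟩
      0#                        ∎

  many-roots⇒zero : ∀ {m} (g : Fin m → Carrier) → (∀ i j → g i ≈ g j → i ≡ j) →
                    ∀ ps → length ps ℕ.≤ m → (∀ i → eval ps (g i) ≈ 0#) → All (_≈ 0#) ps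
  many-roots⇒zero {zero}  g g-inj []      _   _     = []
  many-roots⇒zero {suc m} g g-inj ps      len roots =
    zero-quotient⇒zero r ps (many-roots⇒zero (g ∘ Fin.suc) (λ i j → Fin.suc-injective ∘ g-inj _ _)
                                 (quotient r ps) (length-quotient r ps len) quotient-roots)
                            (roots Fin.zero)
    where
    r = g Fin.zero
    quotient-roots : ∀ i → eval (quotient r ps) (g (Fin.suc i)) ≈ 0#
    quotient-roots i = x*y≈0⇒y≈0 y-r≉0 (begin
      (y - r) * eval (quotient r ps) y          ≈⟨ +-identityʳ _ ⟨
      (y - r) * eval (quotient r ps) y + 0#     ≈⟨ +-congˡ (roots Fin.zero) ⟨
      (y - r) * eval (quotient r ps) y + eval ps r ≈⟨ remainder-theorem r ps y ⟨
      eval ps y                                 ≈⟨ roots (Fin.suc i) ⟩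
      0#                                        ∎)
      where
      y = g (Fin.suc i)
      y-r≉0 : y - r ≉ 0#
      y-r≉0 y-r≈0 with () ← g-inj (Fin.suc i) Fin.zero (x∙y⁻¹≈ε⇒x≈y y r y-r≈0)

  monomial : Carrier → ℕ → List Carrier
  monomial k zero    = k ∷ []
  monomial k (suc e) = 0# ∷ monomial k e

  infixl 6 _⊕_
  _⊕_ : List Carrier → List Carrier → List Carrier
  []       ⊕ ys       = ys
  (x ∷ xs) ⊕ []       = x ∷ xs
  (x ∷ xs) ⊕ (y ∷ ys) = (x + y) ∷ (xs ⊕ ys)

  coeff : List Carrier → ℕ → Carrier
  coeff []       i       = 0#
  coeff (a ∷ as) zero    = a
  coeff (a ∷ as) (suc i) = coeff as i

  eval-monomial : ∀ k e x → eval (monomial k e) x ≈ k * x ^ e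
  eval-monomial k zero    x = trans (trans (+-congˡ (zeroʳ x)) (+-identityʳ k)) (sym (*-identityʳ k))
  eval-monomial k (suc e) x = begin
    0# + x * eval (monomial k e) x  ≈⟨ +-identityˡ _ ⟩
    x * eval (monomial k e) x       ≈⟨ *-congˡ (eval-monomial k e x) ⟩
    x * (k * x ^ e)                 ≈⟨ x∙yz≈y∙xz x k (x ^ e) ⟩
    k * (x * x ^ e)                 ∎
    where open import Algebra.Properties.CommutativeSemigroup *-commutativeSemigroup using (x∙yz≈y∙xz)

  eval-⊕ : ∀ xs ys z → eval (xs ⊕ ys) z ≈ eval xs z + eval ys z
  eval-⊕ []       ys       z = sym (+-identityˡ _)
  eval-⊕ (x ∷ xs) []       z = sym (+-identityʳ _)
  eval-⊕ (x ∷ xs) (y ∷ ys) z = begin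
    (x + y) + z * eval (xs ⊕ ys) z
      ≈⟨ +-congˡ (*-congˡ (eval-⊕ xs ys z)) ⟩
    (x + y) + z * (eval xs z + eval ys z)
      ≈⟨ solve 5 (λ x y z a b → (x :+ y) :+ z :* (a :+ b) := (x :+ z :* a) :+ (y :+ z :* b))
                 refl x y z (eval xs z) (eval ys z) ⟩
    (x + z * eval xs z) + (y + z * eval ys z)
      ∎

  length-monomial : ∀ k e → length (monomial k e) ≡ suc e
  length-monomial k zero    = ≡.refl
  length-monomial k (suc e) = ≡.cong suc (length-monomial k e)

  length-⊕ : ∀ {m} xs ys → length xs ℕ.≤ m → length ys ℕ.≤ m → length (xs ⊕ ys) ℕ.≤ m
  length-⊕ []       ys       _            len-ys       = len-ys
  length-⊕ (x ∷ xs) []       len-xs       _            = len-xs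
  length-⊕ (x ∷ xs) (y ∷ ys) (ℕ.s≤s len-xs) (ℕ.s≤s len-ys) = ℕ.s≤s (length-⊕ xs ys len-xs len-ys)

  coeff-⊕ : ∀ xs ys i → coeff (xs ⊕ ys) i ≈ coeff xs i + coeff ys i
  coeff-⊕ []       ys       i       = sym (+-identityˡ _)
  coeff-⊕ (x ∷ xs) []       zero    = sym (+-identityʳ _)
  coeff-⊕ (x ∷ xs) []       (suc i) = sym (+-identityʳ _)
  coeff-⊕ (x ∷ xs) (y ∷ ys) zero    = refl
  coeff-⊕ (x ∷ xs) (y ∷ ys) (suc i) = coeff-⊕ xs ys i

  coeff-monomial-≡ : ∀ k e → coeff (monomial k e) e ≈ k
  coeff-monomial-≡ k zero    = refl
  coeff-monomial-≡ k (suc e) = coeff-monomial-≡ k e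

  coeff-monomial-≢ : ∀ k e i → e ≢ i → coeff (monomial k e) i ≈ 0#
  coeff-monomial-≢ k zero    zero    e≢i = ⊥-elim (e≢i ≡.refl)
  coeff-monomial-≢ k zero    (suc i) e≢i = refl
  coeff-monomial-≢ k (suc e) zero    e≢i = refl
  coeff-monomial-≢ k (suc e) (suc i) e≢i = coeff-monomial-≢ k e i (e≢i ∘ ≡.cong suc)

  coeff-zero : ∀ ps i → All (_≈ 0#) ps → coeff ps i ≈ 0#
  coeff-zero []       i       _            = refl
  coeff-zero (a ∷ ps) zero    (a≈0 ∷ _)    = a≈0
  coeff-zero (a ∷ ps) (suc i) (_ ∷ ps≈0)   = coeff-zero ps i ps≈0


  ∑monomials : ∀ {m} → (Fin m → Carrier) → (Fin m → ℕ) → List Carrier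
  ∑monomials {zero}  k e = []
  ∑monomials {suc m} k e = monomial (k Fin.zero) (e Fin.zero) ⊕ ∑monomials (k ∘ Fin.suc) (e ∘ Fin.suc)

  eval-∑monomials : ∀ {m} k (e : Fin m → ℕ) x → eval (∑monomials k e) x ≈ sum (λ i → k i * x ^ e i)
  eval-∑monomials {zero}  k e x = refl
  eval-∑monomials {suc m} k e x =
    trans (eval-⊕ (monomial (k Fin.zero) (e Fin.zero)) (∑monomials (k ∘ Fin.suc) (e ∘ Fin.suc)) x)
          (+-cong (eval-monomial (k Fin.zero) (e Fin.zero) x) (eval-∑monomials (k ∘ Fin.suc) (e ∘ Fin.suc) x))

  length-∑monomials : ∀ {m} k (e : Fin m → ℕ) → (∀ i → e i ℕ.< n) → length (∑monomials k e) ℕ.≤ n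
  length-∑monomials {zero}  k e e<n = ℕ.z≤n
  length-∑monomials {suc m} k e e<n =
    length-⊕ (monomial (k Fin.zero) (e Fin.zero)) (∑monomials (k ∘ Fin.suc) (e ∘ Fin.suc))
             (≡.subst (ℕ._≤ n) (≡.sym (length-monomial (k Fin.zero) (e Fin.zero))) (e<n Fin.zero))
                 (length-∑monomials (k ∘ Fin.suc) (e ∘ Fin.suc) (e<n ∘ Fin.suc))

  coeff-∑monomials-∉ : ∀ {m} k (e : Fin m → ℕ) d → (∀ i → e i ≢ d) → coeff (∑monomials k e) d ≈ 0#
  coeff-∑monomials-∉ {zero}  k e d e≢d = refl
  coeff-∑monomials-∉ {suc m} k e d e≢d = begin
    coeff (∑monomials k e) d                        ≈⟨ coeff-⊕ (monomial k₀ e₀) rest d ⟩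
    coeff (monomial k₀ e₀) d + coeff rest d         ≈⟨ +-cong (coeff-monomial-≢ k₀ e₀ d (e≢d Fin.zero))
                                                              (coeff-∑monomials-∉ (k ∘ Fin.suc) (e ∘ Fin.suc) d (e≢d ∘ Fin.suc)) ⟩
    0# + 0#                                         ≈⟨ +-identityˡ 0# ⟩
    0#                                              ∎
    where k₀ = k Fin.zero; e₀ = e Fin.zero; rest = ∑monomials (k ∘ Fin.suc) (e ∘ Fin.suc)

  coeff-∑monomials : ∀ {m} k (e : Fin m → ℕ) → Injective _≡_ _≡_ e → ∀ i → coeff (∑monomials k e) (e i) ≈ k i
  coeff-∑monomials {suc m} k e e-inj Fin.zero = begin
    coeff (∑monomials k e) e₀                  ≈⟨ coeff-⊕ (monomial k₀ e₀) rest e₀ ⟩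
    coeff (monomial k₀ e₀) e₀ + coeff rest e₀  ≈⟨ +-cong (coeff-monomial-≡ k₀ e₀) (coeff-∑monomials-∉ _ _ e₀ e₀∉rest) ⟩
    k₀ + 0#                                    ≈⟨ +-identityʳ k₀ ⟩
    k₀                                         ∎
    where
    k₀ = k Fin.zero; e₀ = e Fin.zero; rest = ∑monomials (k ∘ Fin.suc) (e ∘ Fin.suc)
    e₀∉rest : ∀ i → e (Fin.suc i) ≢ e₀
    e₀∉rest i eq = Fin.0≢1+n (e-inj (≡.sym eq))
  coeff-∑monomials {suc m} k e e-inj (Fin.suc i) = begin
    coeff (∑monomials k e) eᵢ                  ≈⟨ coeff-⊕ (monomial k₀ e₀) rest eᵢ ⟩
    coeff (monomial k₀ e₀) eᵢ + coeff rest eᵢ  ≈⟨ +-cong (coeff-monomial-≢ k₀ e₀ eᵢ (λ eq → Fin.0≢1+n (e-inj eq)))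
                                                         (coeff-∑monomials _ _ (Fin.suc-injective ∘ e-inj) i) ⟩
    0# + k (Fin.suc i)                         ≈⟨ +-identityˡ _ ⟩
    k (Fin.suc i)                              ∎
    where k₀ = k Fin.zero; e₀ = e Fin.zero; eᵢ = e (Fin.suc i); rest = ∑monomials (k ∘ Fin.suc) (e ∘ Fin.suc)

  private
    vanishing-on-enum⇒zero : ∀ {m} k (e : Fin m → ℕ) → Injective _≡_ _≡_ e → (∀ i → e i ℕ.< n) →
                             (∀ j → sum (λ i → k i * enum j ^ e i) ≈ 0#) → ∀ i → k i ≈ 0#
    vanishing-on-enum⇒zero k e e-inj e<n vanish i = begin
      k i                          ≈⟨ coeff-∑monomials k e e-inj i ⟨
      coeff (∑monomials k e) (e i) ≈⟨ coeff-zero (∑monomials k e) (e i) all-coefficients≈0 ⟩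
      0#                           ∎
      where
      all-coefficients≈0 = many-roots⇒zero enum enum-injective (∑monomials k e) (length-∑monomials k e e<n)
                                           (λ j → trans (eval-∑monomials k e (enum j)) (vanish j))

  monomials-independent : ∀ {m} k (e : Fin m → ℕ) → Injective _≡_ _≡_ e → (∀ i → e i ℕ.< n) →
                          (∀ x → sum (λ i → k i * x ^ e i) ≈ 0#) → ∀ i → k i ≈ 0#
  monomials-independent k e e-inj e<n vanish = vanishing-on-enum⇒zero k e e-inj e<n (vanish ∘ enum)

  monomials-nonvanishing : ∀ {m} k (e : Fin m → ℕ) → Injective _≡_ _≡_ e → (∀ i → e i ℕ.< n) →
                           ∀ i → k i ≉ 0# → ∃ λ x → sum (λ i → k i * x ^ e i) ≉ 0#
  monomials-nonvanishing k e e-inj e<n i kᵢ≉0 with Fin.all? (λ j → sum (λ i → k i * enum j ^ e i) ≟ 0#)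
  ... | yes vanish = ⊥-elim (kᵢ≉0 (vanishing-on-enum⇒zero k e e-inj e<n vanish i))
  ... | no ¬vanish = let (j , nonzero) = Fin.¬∀⟶∃¬ n _ (λ j → _ ≟ 0#) ¬vanish in enum j , nonzero

  open import Algebra.Properties.Semiring.Mult semiring using () renaming (_×_ to _·_)

  n·1≈0 : n · 1# ≈ 0#
  n·1≈0 = +-identityʳ-unique (sum enum) (n · 1#) (sym (begin
    sum enum                   ≈⟨ sum-permute enum (permutation shift unshift shift∘unshift unshift∘shift) ⟩
    sum (enum ∘ shift)         ≈⟨ sum-cong-≋ (λ i → enum-index (enum i + 1#)) ⟩
    sum (λ i → enum i + 1#)    ≈⟨ ∑-distrib-+ {n} enum (λ _ → 1#) ⟩
    sum enum + sum {n} (λ _ → 1#) ≈⟨ +-congˡ (sum-replicate n) ⟩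
    sum enum + n · 1#          ∎))
    where
    open import Algebra.Properties.Semiring.Sum semiring using (sum-permute; sum-cong-≋; ∑-distrib-+; sum-replicate)
    open import Algebra.Properties.Ring ring using (+-identityʳ-unique)
    shift unshift : Fin n → Fin n
    shift   i = index (enum i + 1#)
    unshift i = index (enum i - 1#)
    shift∘unshift : ∀ i → shift (unshift i) ≡ i
    shift∘unshift i = enum-injective _ _ (trans (enum-index _) (trans (+-congʳ (enum-index _))
                        (solve 2 (λ a b → (a :- b) :+ b := a) refl (enum i) 1#)))
    unshift∘shift : ∀ i → unshift (shift i) ≡ i
    unshift∘shift i = enum-injective _ _ (trans (enum-index _) (trans (+-congʳ (enum-index _))
                        (solve 2 (λ a b → (a :+ b) :- b := a) refl (enum i) 1#)))

  private
    module Product = Algebra.Properties.CommutativeMonoid.Sum *-commutativeMonoid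

    product-≉0 : ∀ {m} (g : Fin m → Carrier) → (∀ i → g i ≉ 0#) → Product.sum g ≉ 0#
    product-≉0 {zero}  g g≉0 = 1≉0
    product-≉0 {suc m} g g≉0 = *-≉0 (g≉0 Fin.zero) (product-≉0 (g ∘ Fin.suc) (g≉0 ∘ Fin.suc))

    module NonzeroElements {m} (g : Fin (suc m) → Carrier) (g-injective : ∀ i j → g i ≈ g j → i ≡ j)
                           (g-surjective : ∀ x → ∃ λ i → g i ≈ x) where
      i₀ : Fin (suc m)
      i₀ = proj₁ (g-surjective 0#)

      nonzero : Fin m → Carrier
      nonzero j = g (Fin.punchIn i₀ j)

      nonzero≉0 : ∀ j → nonzero j ≉ 0#
      nonzero≉0 j eq = Fin.punchInᵢ≢i i₀ j (g-injective _ _ (trans eq (sym (proj₂ (g-surjective 0#)))))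

      nonzero-injective : ∀ j j′ → nonzero j ≈ nonzero j′ → j ≡ j′
      nonzero-injective j j′ eq = Fin.punchIn-injective i₀ j j′ (g-injective _ _ eq)

      i₀≢index-of-a*nonzero : ∀ {a} → a ≉ 0# → ∀ j → i₀ ≢ proj₁ (g-surjective (a * nonzero j))
      i₀≢index-of-a*nonzero {a} a≉0 j eq = *-≉0 a≉0 (nonzero≉0 j) (begin
        a * nonzero j                           ≈⟨ proj₂ (g-surjective (a * nonzero j)) ⟨
        g (proj₁ (g-surjective (a * nonzero j))) ≡⟨ ≡.cong g eq ⟨
        g i₀                                    ≈⟨ proj₂ (g-surjective 0#) ⟩
        0#                                      ∎)

      scale : ∀ {a} → a ≉ 0# → Fin m → Fin m
      scale a≉0 j = Fin.punchOut (i₀≢index-of-a*nonzero a≉0 j)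

      nonzero∘scale : ∀ {a} (a≉0 : a ≉ 0#) j → nonzero (scale a≉0 j) ≈ a * nonzero j
      nonzero∘scale {a} a≉0 j = trans (reflexive (≡.cong g (Fin.punchIn-punchOut (i₀≢index-of-a*nonzero a≉0 j))))
                                      (proj₂ (g-surjective (a * nonzero j)))

      scale-inverse : ∀ {a b} (a≉0 : a ≉ 0#) (b≉0 : b ≉ 0#) → b * a ≈ 1# → ∀ j → scale a≉0 (scale b≉0 j) ≡ j
      scale-inverse {a} {b} a≉0 b≉0 ba≈1 j = nonzero-injective _ _ (begin
        nonzero (scale a≉0 (scale b≉0 j)) ≈⟨ nonzero∘scale a≉0 _ ⟩
        a * nonzero (scale b≉0 j)         ≈⟨ *-congˡ (nonzero∘scale b≉0 j) ⟩
        a * (b * nonzero j)               ≈⟨ *-assoc a b _ ⟨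
        (a * b) * nonzero j               ≈⟨ *-congʳ (trans (*-comm a b) ba≈1) ⟩
        1# * nonzero j                    ≈⟨ *-identityˡ _ ⟩
        nonzero j                         ∎)

      -- Multiplication by x permutes the nonzero elements, so it fixes their product.
      product-invariant : ∀ {x} → x ≉ 0# → Product.sum nonzero ≈ x ^ m * Product.sum nonzero
      product-invariant {x} x≉0 = begin
        Product.sum nonzero                             ≈⟨ Product.sum-permute nonzero π ⟩
        Product.sum (nonzero ∘ scale x≉0)               ≈⟨ Product.sum-cong-≋ (nonzero∘scale x≉0) ⟩
        Product.sum (λ j → x * nonzero j)               ≈⟨ Product.∑-distrib-+ (λ _ → x) nonzero ⟩
        Product.sum {m} (λ _ → x) * Product.sum nonzero ≈⟨ *-congʳ (Product.sum-replicate m) ⟩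
        x ^ m * Product.sum nonzero                     ∎
        where
        π = permutation (scale x≉0) (scale (x⁻¹≉0 x≉0))
                        (scale-inverse x≉0 (x⁻¹≉0 x≉0) (x⁻¹*x≈1 x≉0)) (scale-inverse (x⁻¹≉0 x≉0) x≉0 (x*x⁻¹≈1 x≉0))

    x^[m∸1]≈1 : ∀ m (g : Fin m → Carrier) → (∀ i j → g i ≈ g j → i ≡ j) → (∀ x → ∃ λ i → g i ≈ x) →
                ∀ {x} → x ≉ 0# → x ^ (m ∸ 1) ≈ 1#
    x^[m∸1]≈1 zero    g g-inj g-surj {x} x≉0 with () ← proj₁ (g-surj x)
    x^[m∸1]≈1 (suc m) g g-inj g-surj {x} x≉0 = *-cancelˡ (product-≉0 nonzero nonzero≉0) (begin
      Product.sum nonzero * x ^ m  ≈⟨ *-comm _ _ ⟩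
      x ^ m * Product.sum nonzero  ≈⟨ product-invariant x≉0 ⟨
      Product.sum nonzero          ≈⟨ *-identityʳ _ ⟨
      Product.sum nonzero * 1#     ∎)
      where open NonzeroElements g g-inj g-surj

  x^[n∸1]≈1 : ∀ {x} → x ≉ 0# → x ^ (n ∸ 1) ≈ 1#
  x^[n∸1]≈1 = x^[m∸1]≈1 n enum enum-injective (λ x → index x , enum-index x)

  x^n≈x : ∀ x → x ^ n ≈ x
  x^n≈x x = trans (reflexive (≡.cong (x ^_) (nonempty (index 0#)))) x*x^[n∸1]≈x
    where
    nonempty : ∀ {m} → Fin m → m ≡ suc (m ∸ 1)
    nonempty {suc m} _ = ≡.refl
    x*x^[n∸1]≈x : x * x ^ (n ∸ 1) ≈ x
    x*x^[n∸1]≈x with x ≟ 0#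
    ... | yes x≈0 = trans (*-congʳ x≈0) (trans (zeroˡ _) (sym x≈0))
    ... | no x≉0  = trans (*-congˡ (x^[n∸1]≈1 x≉0)) (*-identityʳ x)


module Frobenius {c ℓ} (F : CommutativeRing c ℓ) (q : ℕ) (isPrimePower : IsPrimePower q)
                 (isFiniteField : IsFiniteFieldOfOrder F (q ℕ.^ 3)) where
  open CommutativeRing F
  open FiniteField F isFiniteField public
  open Plane F q using (pow; fr)
  open import Algebra.Properties.Ring ring using (x+x≈x⇒x≈0; +-inverseˡ-unique)
  open import Algebra.Properties.Semiring.Exp semiring using (_^_; ^-congˡ; ^-assocʳ; ^-homo-*)
  open import Algebra.Properties.CommutativeSemiring.Exp commutativeSemiring using (^-distrib-*)
  open import Algebra.Properties.Semiring.Mult semiring using (×1-homo-*) renaming (_×_ to _·_)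
  open import Algebra.Properties.Semiring.Sum semiring using (sum; sum-cong-≋)
  open import Relation.Binary.Reasoning.Setoid setoid
  open IntegerCoefficients F

  private
    p k : ℕ
    p = proj₁ isPrimePower
    k = proj₁ (proj₂ isPrimePower)

    p-prime : Prime p
    p-prime = proj₁ (proj₂ (proj₂ isPrimePower))

    q≡p^k : q ≡ p ℕ.^ k
    q≡p^k = proj₂ (proj₂ (proj₂ (proj₂ isPrimePower)))

  2≤q : 2 ℕ.≤ q
  2≤q = primePower⇒2≤ isPrimePower

  p·1≈0 : p · 1# ≈ 0#
  p·1≈0 = p^j·1≈0⇒p·1≈0 (k ℕ.* 3) (≡.subst (λ m → m · 1# ≈ 0#) q³≡p^[k*3] n·1≈0)
    where
    p^j·1≈0⇒p·1≈0 : ∀ j → (p ℕ.^ j) · 1# ≈ 0# → p · 1# ≈ 0#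
    p^j·1≈0⇒p·1≈0 zero    1+0≈0 = ⊥-elim (1≉0 (trans (sym (+-identityʳ 1#)) 1+0≈0))
    p^j·1≈0⇒p·1≈0 (suc j) eq with x*y≈0⇒x≈0⊎y≈0 (trans (sym (×1-homo-* p (p ℕ.^ j))) eq)
    ... | inj₁ p·1≈0      = p·1≈0
    ... | inj₂ p^j·1≈0    = p^j·1≈0⇒p·1≈0 j p^j·1≈0
    q³≡p^[k*3] : q ℕ.^ 3 ≡ p ℕ.^ (k ℕ.* 3)
    q³≡p^[k*3] = ≡.trans (≡.cong (ℕ._^ 3) q≡p^k) (ℕ.^-*-assoc p k 3)

  pow≈^ : ∀ x m → pow x m ≈ x ^ m
  pow≈^ x zero    = refl
  pow≈^ x (suc m) = *-congˡ (pow≈^ x m)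

  fr≈^q : ∀ x → fr x ≈ x ^ q
  fr≈^q x = pow≈^ x q

  fr-cong : ∀ {x y} → x ≈ y → fr x ≈ fr y
  fr-cong {x} {y} x≈y = trans (fr≈^q x) (trans (^-congˡ q x≈y) (sym (fr≈^q y)))

  fr-homo-* : ∀ x y → fr (x * y) ≈ fr x * fr y
  fr-homo-* x y = trans (fr≈^q (x * y)) (trans (^-distrib-* x y q) (sym (*-cong (fr≈^q x) (fr≈^q y))))

  fr-homo-+ : ∀ x y → fr (x + y) ≈ fr x + fr y
  fr-homo-+ x y = begin
    fr (x + y)                     ≈⟨ fr≈^q (x + y) ⟩
    (x + y) ^ q                    ≡⟨ ≡.cong ((x + y) ^_) q≡p^k ⟩
    (x + y) ^ (p ℕ.^ k)            ≈⟨ freshman's-dream-^ p·1≈0 k x y ⟩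
    x ^ (p ℕ.^ k) + y ^ (p ℕ.^ k)  ≡⟨ ≡.cong₂ (λ a b → x ^ a + y ^ b) q≡p^k q≡p^k ⟨
    x ^ q + y ^ q                  ≈⟨ +-cong (fr≈^q x) (fr≈^q y) ⟨
    fr x + fr y                    ∎
    where open CharacteristicPrime F p-prime using (freshman's-dream-^)

  fr-0 : fr 0# ≈ 0#
  fr-0 = x+x≈x⇒x≈0 (fr 0#) (trans (sym (fr-homo-+ 0# 0#)) (fr-cong (+-identityˡ 0#)))

  fr-≈0 : ∀ {x} → x ≈ 0# → fr x ≈ 0#
  fr-≈0 x≈0 = trans (fr-cong x≈0) fr-0

  fr-1 : fr 1# ≈ 1#
  fr-1 = pow-1 q
    where
    pow-1 : ∀ m → pow 1# m ≈ 1#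
    pow-1 zero    = refl
    pow-1 (suc m) = trans (*-identityˡ _) (pow-1 m)

  fr-neg : ∀ x → fr (- x) ≈ - fr x
  fr-neg x = +-inverseˡ-unique (fr (- x)) (fr x)
               (trans (sym (fr-homo-+ (- x) x)) (trans (fr-cong (-‿inverseˡ x)) fr-0))

  fr-homo-sub : ∀ x y → fr (x - y) ≈ fr x - fr y
  fr-homo-sub x y = trans (fr-homo-+ x (- y)) (+-congˡ (fr-neg y))

  fr³≈id : ∀ x → fr (fr (fr x)) ≈ x
  fr³≈id x = begin
    fr (fr (fr x))          ≈⟨ trans (fr≈^q _) (^-congˡ q (trans (fr≈^q _) (^-congˡ q (fr≈^q x)))) ⟩
    ((x ^ q) ^ q) ^ q       ≈⟨ ^-congˡ q (^-assocʳ x q q) ⟩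
    (x ^ (q ℕ.* q)) ^ q     ≈⟨ ^-assocʳ x (q ℕ.* q) q ⟩
    x ^ (q ℕ.* q ℕ.* q)     ≡⟨ ≡.cong (x ^_) q*q*q≡q³ ⟩
    x ^ (q ℕ.^ 3)           ≈⟨ x^n≈x x ⟩
    x                       ∎
    where
    q*q*q≡q³ : q ℕ.* q ℕ.* q ≡ q ℕ.^ 3
    q*q*q≡q³ = ≡.trans (ℕ.*-assoc q q q) (≡.cong (λ m → q ℕ.* (q ℕ.* m)) (≡.sym (ℕ.*-identityʳ q)))

  fr-injective : ∀ {x y} → fr x ≈ fr y → x ≈ y
  fr-injective {x} {y} eq = trans (sym (fr³≈id x)) (trans (fr-cong (fr-cong eq)) (fr³≈id y))

  fr-≉0 : ∀ {x} → x ≉ 0# → fr x ≉ 0#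
  fr-≉0 x≉0 frx≈0 = x≉0 (fr-injective (trans frx≈0 (sym fr-0)))

  fr-⁻¹ : ∀ {x} → x ≉ 0# → fr (x ⁻¹) ≈ (fr x) ⁻¹
  fr-⁻¹ {x} x≉0 = x*y≈1⇒y≈x⁻¹ (fr-≉0 x≉0) (trans (sym (fr-homo-* x (x ⁻¹))) (trans (fr-cong (x*x⁻¹≈1 x≉0)) fr-1))

  N : Carrier → Carrier
  N x = x * (fr x * fr (fr x))

  N-cong : ∀ {x y} → x ≈ y → N x ≈ N y
  N-cong x≈y = *-cong x≈y (*-cong (fr-cong x≈y) (fr-cong (fr-cong x≈y)))

  N-homo-* : ∀ x y → N (x * y) ≈ N x * N y
  N-homo-* x y = begin
    (x * y) * (fr (x * y) * fr (fr (x * y)))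
      ≈⟨ *-congˡ (*-cong (fr-homo-* x y) (trans (fr-cong (fr-homo-* x y)) (fr-homo-* _ _))) ⟩
    (x * y) * ((fr x * fr y) * (fr (fr x) * fr (fr y)))
      ≈⟨ solve 6 (λ a b c d e f → (a :* b) :* ((c :* d) :* (e :* f)) := (a :* (c :* e)) :* (b :* (d :* f)))
                 refl x y (fr x) (fr y) (fr (fr x)) (fr (fr y)) ⟩
    N x * N y
      ∎

  N∘fr≈N : ∀ x → N (fr x) ≈ N x
  N∘fr≈N x = begin
    fr x * (fr (fr x) * fr (fr (fr x)))   ≈⟨ *-congˡ (*-congˡ (fr³≈id x)) ⟩
    fr x * (fr (fr x) * x)                ≈⟨ solve 3 (λ a b c → a :* (b :* c) := c :* (a :* b)) refl (fr x) (fr (fr x)) x ⟩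
    N x                                   ∎

  fr∘N≈N : ∀ x → fr (N x) ≈ N x
  fr∘N≈N x = begin
    fr (x * (fr x * fr (fr x)))           ≈⟨ trans (fr-homo-* _ _) (*-congˡ (fr-homo-* _ _)) ⟩
    N (fr x)                              ≈⟨ N∘fr≈N x ⟩
    N x                                   ∎

  N-≉0 : ∀ {x} → x ≉ 0# → N x ≉ 0#
  N-≉0 x≉0 = *-≉0 x≉0 (*-≉0 (fr-≉0 x≉0) (fr-≉0 (fr-≉0 x≉0)))

  N-neg : ∀ x → N (- x) ≈ - N x
  N-neg x = begin
    - x * (fr (- x) * fr (fr (- x)))
      ≈⟨ *-congˡ (*-cong (fr-neg x) (trans (fr-cong (fr-neg x)) (fr-neg (fr x)))) ⟩
    - x * (- fr x * - fr (fr x))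
      ≈⟨ solve 3 (λ a b c → (:- a) :* ((:- b) :* (:- c)) := :- (a :* (b :* c))) refl x (fr x) (fr (fr x)) ⟩
    - N x
      ∎

  N-≈0 : ∀ {x} → x ≈ 0# → N x ≈ 0#
  N-≈0 x≈0 = trans (*-congʳ x≈0) (zeroˡ _)

  N-1 : N 1# ≈ 1#
  N-1 = trans (*-identityˡ _) (trans (*-cong fr-1 (trans (fr-cong fr-1) fr-1)) (*-identityˡ 1#))

  qMonomial : Digits → Carrier → Carrier
  qMonomial (i , j , k) x = x ^ i * (fr x ^ j * fr (fr x) ^ k)

  ^fromDigits : ∀ x d → x ^ fromDigits q d ≈ qMonomial d x
  ^fromDigits x (i , j , k) = begin
    x ^ (i ℕ.+ q ℕ.* (j ℕ.+ q ℕ.* k))            ≈⟨ ^-homo-* x i _ ⟩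
    x ^ i * x ^ (q ℕ.* (j ℕ.+ q ℕ.* k))          ≈⟨ *-congˡ (^-assocʳ x q _) ⟨
    x ^ i * (x ^ q) ^ (j ℕ.+ q ℕ.* k)            ≈⟨ *-congˡ (^-homo-* (x ^ q) j _) ⟩
    x ^ i * ((x ^ q) ^ j * (x ^ q) ^ (q ℕ.* k))  ≈⟨ *-congˡ (*-congˡ (^-assocʳ (x ^ q) q k)) ⟨
    x ^ i * ((x ^ q) ^ j * ((x ^ q) ^ q) ^ k)    ≈⟨ *-congˡ (*-cong (^-congˡ j (sym (fr≈^q x)))
                                                      (^-congˡ k (trans (^-congˡ q (sym (fr≈^q x))) (sym (fr≈^q (fr x)))))) ⟩
    x ^ i * (fr x ^ j * fr (fr x) ^ k)           ∎

  private
    sum-qMonomials : ∀ {m} (κ : Fin m → Carrier) (d : Fin m → Digits) x →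
                     sum (λ i → κ i * x ^ fromDigits q (d i)) ≈ sum (λ i → κ i * qMonomial (d i) x)
    sum-qMonomials κ d x = sum-cong-≋ (λ i → *-congˡ (^fromDigits x (d i)))

  qMonomials-independent : ∀ {m} (κ : Fin m → Carrier) (d : Fin m → Digits) → Injective _≡_ _≡_ d →
                           (∀ i → DigitsBelow q (d i)) →
                           (∀ x → sum (λ i → κ i * qMonomial (d i) x) ≈ 0#) → ∀ i → κ i ≈ 0#
  qMonomials-independent κ d d-inj d<q vanish =
    monomials-independent κ (fromDigits q ∘ d) (d-inj ∘ fromDigits-injective (d<q _) (d<q _)) (fromDigits-< ∘ d<q)
                          (λ x → trans (sum-qMonomials κ d x) (vanish x))

  qMonomials-nonvanishing : ∀ {m} (κ : Fin m → Carrier) (d : Fin m → Digits) → Injective _≡_ _≡_ d →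
                            (∀ i → DigitsBelow q (d i)) →
                            ∀ i → κ i ≉ 0# → ∃ λ x → sum (λ i → κ i * qMonomial (d i) x) ≉ 0#
  qMonomials-nonvanishing κ d d-inj d<q i κᵢ≉0
    with x , nonzero ← monomials-nonvanishing κ (fromDigits q ∘ d) (d-inj ∘ fromDigits-injective (d<q _) (d<q _))
                                              (fromDigits-< ∘ d<q) i κᵢ≉0
    = x , nonzero ∘ trans (sum-qMonomials κ d x)

  -- y = c + w c^q + w w^q c^{q²} satisfies y = w y^q when N w = 1, and since the q-monomials are
  -- independent, c can be chosen with y ≠ 0.
  N≈1⇒fixed-point : ∀ {w} → N w ≈ 1# → ∃ λ y → y ≉ 0# × y ≈ w * fr y
  N≈1⇒fixed-point {w} Nw≈1 = y , y≉0 , y≈w*fry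
    where
    κ : Fin 3 → Carrier
    κ 0F = 1#
    κ 1F = w
    κ 2F = w * fr w
    d : Fin 3 → Digits
    d 0F = 1 , 0 , 0
    d 1F = 0 , 1 , 0
    d 2F = 0 , 0 , 1
    position : Digits → Fin 3
    position (1 , _ , _) = 0F
    position (_ , 1 , _) = 1F
    position _           = 2F
    d-injective : Injective _≡_ _≡_ d
    d-injective = inverseʳ⇒injective d (strictlyInverseʳ⇒inverseʳ {f⁻¹ = position} d λ
      { 0F → ≡.refl ; 1F → ≡.refl ; 2F → ≡.refl })
    0<q : 0 ℕ.< q
    0<q = ℕ.<-trans (ℕ.s≤s ℕ.z≤n) 2≤q
    d<q : ∀ i → DigitsBelow q (d i)
    d<q 0F = 2≤q , 0<q , 0<q
    d<q 1F = 0<q , 2≤q , 0<q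
    d<q 2F = 0<q , 0<q , 2≤q
    nonvanishing = qMonomials-nonvanishing κ d d-injective d<q 0F 1≉0
    c₀ = proj₁ nonvanishing
    y = c₀ + w * fr c₀ + (w * fr w) * fr (fr c₀)
    y≉0 : y ≉ 0#
    y≉0 y≈0 = proj₂ nonvanishing (trans (solve 5
      (λ c c₁ c₂ w w₁ → con (+ 1) :* (c :^ 1 :* (c₁ :^ 0 :* c₂ :^ 0))
                        :+ (w :* (c :^ 0 :* (c₁ :^ 1 :* c₂ :^ 0)) :+ ((w :* w₁) :* (c :^ 0 :* (c₁ :^ 0 :* c₂ :^ 1)) :+ con (+ 0)))
                        := c :+ w :* c₁ :+ (w :* w₁) :* c₂) refl c₀ (fr c₀) (fr (fr c₀)) w (fr w)) y≈0)
    y≈w*fry : y ≈ w * fr y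
    y≈w*fry = sym (begin
      w * fr y
        ≈⟨ *-congˡ (trans (fr-homo-+ _ _) (+-cong (fr-homo-+ _ _) (fr-homo-* _ _))) ⟩
      w * (fr c₀ + fr (w * fr c₀) + fr (w * fr w) * fr (fr (fr c₀)))
        ≈⟨ *-congˡ (+-cong (+-congˡ (fr-homo-* _ _)) (*-cong (fr-homo-* _ _) (fr³≈id c₀))) ⟩
      w * (fr c₀ + fr w * fr (fr c₀) + (fr w * fr (fr w)) * c₀)
        ≈⟨ solve 6 (λ w c₁ c₂ c w₁ w₂ → w :* (c₁ :+ w₁ :* c₂ :+ (w₁ :* w₂) :* c)
                                       := w :* c₁ :+ (w :* w₁) :* c₂ :+ (w :* (w₁ :* w₂)) :* c) refl
                   w (fr c₀) (fr (fr c₀)) c₀ (fr w) (fr (fr w)) ⟩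
      w * fr c₀ + (w * fr w) * fr (fr c₀) + N w * c₀
        ≈⟨ +-congˡ (trans (*-congʳ Nw≈1) (*-identityˡ c₀)) ⟩
      w * fr c₀ + (w * fr w) * fr (fr c₀) + c₀
        ≈⟨ solve 3 (λ a b c → a :+ b :+ c := c :+ a :+ b) refl (w * fr c₀) ((w * fr w) * fr (fr c₀)) c₀ ⟩
      y ∎)

  hilbert90 : ∀ {a b} → a ≉ 0# → N a ≈ N b → ∃ λ y → y ≉ 0# × a * y ≈ b * fr y
  hilbert90 {a} {b} a≉0 Na≈Nb = solution (N≈1⇒fixed-point Nw≈1)
    where
    w = b * a ⁻¹
    Nw≈1 : N w ≈ 1#
    Nw≈1 = begin
      N (b * a ⁻¹)        ≈⟨ N-homo-* b (a ⁻¹) ⟩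
      N b * N (a ⁻¹)      ≈⟨ *-congʳ Na≈Nb ⟨
      N a * N (a ⁻¹)      ≈⟨ N-homo-* a (a ⁻¹) ⟨
      N (a * a ⁻¹)        ≈⟨ N-cong (x*x⁻¹≈1 a≉0) ⟩
      N 1#                ≈⟨ N-1 ⟩
      1#                  ∎
    solution : (∃ λ y → y ≉ 0# × y ≈ w * fr y) → ∃ λ y → y ≉ 0# × a * y ≈ b * fr y
    solution (y , y≉0 , y≈w*fry) = y , y≉0 , (begin
      a * y               ≈⟨ *-congˡ y≈w*fry ⟩
      a * (w * fr y)      ≈⟨ *-assoc a w _ ⟨
      (a * w) * fr y      ≈⟨ *-congʳ (trans (x∙yz≈y∙xz a b (a ⁻¹)) (trans (*-congˡ (x*x⁻¹≈1 a≉0)) (*-identityʳ b))) ⟩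
      b * fr y            ∎)
      where open import Algebra.Properties.CommutativeSemigroup *-commutativeSemigroup using (x∙yz≈y∙xz)

  q≡2⇒N≈1 : q ≡ 2 → ∀ {x} → x ≉ 0# → N x ≈ 1#
  q≡2⇒N≈1 ≡.refl {x} x≉0 = trans (solve 1 (λ x → x :* (x :^ 2 :* (x :^ 2) :^ 2) := x :^ 7) refl x) (x^[n∸1]≈1 x≉0)


module Projection {c ℓ} (F : CommutativeRing c ℓ) (q : ℕ) (isPrimePower : IsPrimePower q)
                  (isFiniteField : IsFiniteFieldOfOrder F (q ℕ.^ 3)) (p₁ p₂ p₃ : CommutativeRing.Carrier F) where
  open CommutativeRing F
  open Frobenius F q isPrimePower isFiniteField
  open Plane F q
  open IntegerCoefficients F
  open import Algebra.Properties.Ring ring using (x∙y⁻¹≈ε⇒x≈y; x≈y⇒x∙y⁻¹≈ε; -‿injective; +-inverseˡ-unique; -0#≈0#)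
  open import Relation.Binary.Reasoning.Setoid setoid

  P : Triple
  P = (p₁ , p₂ , p₃)

  A B : Carrier → Carrier
  A x = p₃ * x - p₁ * fr (fr x)
  B x = p₃ * fr x - p₂ * fr (fr x)

  OnmT⇒≈0 : ∀ {y₁ y₂ y₃} → OnmT (y₁ , y₂ , y₃) → y₃ ≈ 0#
  OnmT⇒≈0 {y₁} {y₂} {y₃} = trans (sym (solve 3 (λ a b c → con (+ 0) :* a :+ con (+ 0) :* b :+ con (+ 1) :* c := c) refl y₁ y₂ y₃))

  ≈0⇒OnmT : ∀ {y₁ y₂ y₃} → y₃ ≈ 0# → OnmT (y₁ , y₂ , y₃)
  ≈0⇒OnmT {y₁} {y₂} {y₃} = trans (solve 3 (λ a b c → con (+ 0) :* a :+ con (+ 0) :* b :+ con (+ 1) :* c := c) refl y₁ y₂ y₃)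

  det-projection : ∀ x {y₁ y₂ y₃} → y₃ ≈ 0# → det P (x , fr x , fr (fr x)) (y₁ , y₂ , y₃) ≈ y₂ * A x - y₁ * B x
  det-projection x {y₁} {y₂} {y₃} y₃≈0 = begin
    det P (x , fr x , fr (fr x)) (y₁ , y₂ , y₃)
      ≈⟨ solve 9 (λ a b d e f g h i j →
           a :* (f :* j :- g :* i) :- b :* (e :* j :- g :* h) :+ d :* (e :* i :- f :* h)
           := j :* (a :* f :- b :* e) :+ (i :* (d :* e :- a :* g) :- h :* (d :* f :- b :* g))) refl
           p₁ p₂ p₃ x (fr x) (fr (fr x)) y₁ y₂ y₃ ⟩
    y₃ * (p₁ * fr x - p₂ * x) + (y₂ * A x - y₁ * B x) ≈⟨ +-congʳ (trans (*-congʳ y₃≈0) (zeroˡ _)) ⟩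
    0# + (y₂ * A x - y₁ * B x)                        ≈⟨ +-identityˡ _ ⟩
    y₂ * A x - y₁ * B x                               ∎

  A-≈0 : ∀ {x} → x ≈ 0# → A x ≈ 0#
  A-≈0 x≈0 = trans (+-cong (trans (*-congˡ x≈0) (zeroʳ p₃)) (-‿cong (trans (*-congˡ (fr-≈0 (fr-≈0 x≈0))) (zeroʳ p₁))))
                   (trans (+-congˡ -0#≈0#) (+-identityʳ 0#))

  B-≈0 : ∀ {x} → x ≈ 0# → B x ≈ 0#
  B-≈0 x≈0 = trans (+-cong (trans (*-congˡ (fr-≈0 x≈0)) (zeroʳ p₃)) (-‿cong (trans (*-congˡ (fr-≈0 (fr-≈0 x≈0))) (zeroʳ p₂))))
                   (trans (+-congˡ -0#≈0#) (+-identityʳ 0#))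

  fr∘B : ∀ x → fr (B x) ≈ fr p₃ * fr (fr x) - fr p₂ * x
  fr∘B x = trans (fr-homo-sub _ _) (+-cong (fr-homo-* _ _) (-‿cong (trans (fr-homo-* _ _) (*-congˡ (fr³≈id x)))))

  fr∘A : ∀ x → fr (A x) ≈ fr p₃ * fr x - fr p₁ * x
  fr∘A x = trans (fr-homo-sub _ _) (+-cong (fr-homo-* _ _) (-‿cong (trans (fr-homo-* _ _) (*-congˡ (fr³≈id x)))))

  -- Cramer's rule for the linear system B x = u, (B x)^q = u^q, (B x)^{q²} = u^{q²} in the unknowns
  -- x, x^q, x^{q²}, whose determinant is D = N p₃ - N p₂.
  B-surjective : N p₃ ≉ N p₂ → ∀ u → ∃ λ x → B x ≈ u
  B-surjective Np₃≉Np₂ u = S₀ * D ⁻¹ , (begin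
    p₃ * fr (S₀ * D ⁻¹) - p₂ * fr (fr (S₀ * D ⁻¹))
      ≈⟨ +-cong (*-congˡ (trans (fr-homo-* _ _) (*-cong frS₀ frD⁻¹)))
                (-‿cong (*-congˡ (trans (fr-cong (fr-homo-* _ _)) (trans (fr-homo-* _ _) (*-cong (trans (fr-cong frS₀) frS₁)
                                    (trans (fr-cong frD⁻¹) frD⁻¹)))))) ⟩
    p₃ * (S₁ * D ⁻¹) - p₂ * (S₂ * D ⁻¹)
      ≈⟨ solve 10 (λ a b c a₁ b₁ c₁ a₂ b₂ c₂ i →
           a :* ((a₁ :* a₂ :* c :+ b₁ :* b :* c₂ :+ c₁ :* a₂ :* b) :* i)
           :- b :* ((a₂ :* a :* c₁ :+ b₂ :* b₁ :* c :+ c₂ :* a :* b₁) :* i)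
           := c :* ((a :* (a₁ :* a₂) :- b :* (b₁ :* b₂)) :* i)) refl
           p₃ p₂ u (fr p₃) (fr p₂) (fr u) (fr (fr p₃)) (fr (fr p₂)) (fr (fr u)) (D ⁻¹) ⟩
    u * (D * D ⁻¹)                           ≈⟨ *-congˡ (x*x⁻¹≈1 D≉0) ⟩
    u * 1#                                   ≈⟨ *-identityʳ u ⟩
    u                                        ∎)
    where
    D = N p₃ - N p₂
    D≉0 : D ≉ 0#
    D≉0 = Np₃≉Np₂ ∘ x∙y⁻¹≈ε⇒x≈y _ _
    frD⁻¹ : fr (D ⁻¹) ≈ D ⁻¹
    frD⁻¹ = x*y≈1⇒y≈x⁻¹ D≉0 (begin
      D * fr (D ⁻¹)        ≈⟨ *-congʳ (trans (fr-homo-sub _ _) (+-cong (fr∘N≈N p₃) (-‿cong (fr∘N≈N p₂)))) ⟨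
      fr D * fr (D ⁻¹)     ≈⟨ fr-homo-* D (D ⁻¹) ⟨
      fr (D * D ⁻¹)        ≈⟨ fr-cong (x*x⁻¹≈1 D≉0) ⟩
      fr 1#                ≈⟨ fr-1 ⟩
      1#                   ∎)
    S₀ S₁ S₂ : Carrier
    S₀ = p₃ * fr p₃ * fr (fr u) + p₂ * fr (fr p₂) * fr u + u * fr p₃ * fr (fr p₂)
    S₁ = fr p₃ * fr (fr p₃) * u + fr p₂ * p₂ * fr (fr u) + fr u * fr (fr p₃) * p₂
    S₂ = fr (fr p₃) * p₃ * fr u + fr (fr p₂) * fr p₂ * u + fr (fr u) * p₃ * fr p₂
    frS₀ : fr S₀ ≈ S₁
    frS₀ = trans (trans (fr-homo-+ _ _) (+-congʳ (fr-homo-+ _ _)))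
                 (+-cong (+-cong (trans (fr-homo-* _ _) (*-cong (fr-homo-* _ _) (fr³≈id u)))
                                 (trans (fr-homo-* _ _) (*-congʳ (trans (fr-homo-* _ _) (*-congˡ (fr³≈id p₂))))))
                         (trans (fr-homo-* _ _) (*-cong (fr-homo-* _ _) (fr³≈id p₂))))
    frS₁ : fr S₁ ≈ S₂
    frS₁ = trans (trans (fr-homo-+ _ _) (+-congʳ (fr-homo-+ _ _)))
                 (+-cong (+-cong (trans (fr-homo-* _ _) (*-congʳ (trans (fr-homo-* _ _) (*-congˡ (fr³≈id p₃)))))
                                 (trans (fr-homo-* _ _) (*-cong (fr-homo-* _ _) (fr³≈id u))))
                         (trans (fr-homo-* _ _) (*-congʳ (trans (fr-homo-* _ _) (*-congˡ (fr³≈id p₃))))))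

  det-φL-orbit : ∀ {a b d} → d ≈ 0# → det (a , b , d) (φL (a , b , d)) (φL (φL (a , b , d))) ≈ N a + N b
  det-φL-orbit {a} {b} {d} d≈0 = begin
    det (a , b , d) (φL (a , b , d)) (φL (φL (a , b , d)))
      ≈⟨ solve 9 (λ a b d a₁ b₁ a₂ b₂ d₁ d₂ →
           a :* (a₁ :* a₂ :- b₁ :* d₂) :- b :* (d₁ :* a₂ :- b₁ :* b₂) :+ d :* (d₁ :* d₂ :- a₁ :* b₂)
           := (a :* (a₁ :* a₂) :+ b :* (b₁ :* b₂))
              :+ (d₂ :* (:- (a :* b₁)) :+ d₁ :* (:- (b :* a₂)) :+ d :* (d₁ :* d₂ :- a₁ :* b₂)))
           refl a b d (fr a) (fr b) (fr (fr a)) (fr (fr b)) (fr d) (fr (fr d)) ⟩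
    (N a + N b) + (fr (fr d) * - (a * fr b) + fr d * - (b * fr (fr a)) + d * (fr d * fr (fr d) - fr a * fr (fr b)))
      ≈⟨ +-congˡ (+-cong (+-cong (annihilate fr²d≈0) (annihilate frd≈0)) (annihilate d≈0)) ⟩
    (N a + N b) + (0# + 0# + 0#)
      ≈⟨ +-congˡ (trans (+-identityʳ _) (+-identityʳ 0#)) ⟩
    (N a + N b) + 0#
      ≈⟨ +-identityʳ _ ⟩
    N a + N b ∎
    where
    annihilate : ∀ {x y} → x ≈ 0# → x * y ≈ 0#
    annihilate x≈0 = trans (*-congʳ x≈0) (zeroˡ _)
    frd≈0 = fr-≈0 d≈0
    fr²d≈0 = fr-≈0 frd≈0

  φL-incidence : ∀ {a b d} → d ≈ 0# → fr d * p₁ + fr a * p₂ + fr b * p₃ ≈ fr a * p₂ + fr b * p₃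
  φL-incidence d≈0 = trans (+-congʳ (+-congʳ (trans (*-congʳ (fr-≈0 d≈0)) (zeroˡ p₁)))) (+-congʳ (+-identityˡ _))

  φL²-incidence : ∀ {a b d} → d ≈ 0# → fr (fr b) * p₁ + fr (fr d) * p₂ + fr (fr a) * p₃ ≈ fr (fr b) * p₁ + fr (fr a) * p₃
  φL²-incidence d≈0 =
    trans (+-congʳ (+-congˡ (trans (*-congʳ (fr-≈0 (fr-≈0 d≈0))) (zeroˡ p₂)))) (+-congʳ (+-identityʳ _))

  Sθ⇒≉0 : ∀ {θ y₁ y₂ y₃} → θ ≉ 0# → Sθ θ (y₁ , y₂ , y₃) → y₁ ≉ 0# × y₂ ≉ 0#
  Sθ⇒≉0 θ≉0 (z , z≉0 , t , t≉0 , y₁≈ , y₂≈ , _) =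
    (λ y₁≈0 → *-≉0 t≉0 (*-≉0 z≉0 θ≉0) (trans (sym y₁≈) y₁≈0)) ,
    (λ y₂≈0 → *-≉0 t≉0 (fr-≉0 z≉0) (trans (sym y₂≈) y₂≈0))

  Sθ⇒N≈ : ∀ {θ y₁ y₂ y₃} → Sθ θ (y₁ , y₂ , y₃) → N y₁ ≈ N θ * N y₂
  Sθ⇒N≈ {θ} {y₁} {y₂} (z , _ , t , _ , y₁≈ , y₂≈ , _) = begin
    N y₁                   ≈⟨ N-cong y₁≈ ⟩
    N (t * (z * θ))        ≈⟨ trans (N-homo-* _ _) (*-congˡ (N-homo-* _ _)) ⟩
    N t * (N z * N θ)      ≈⟨ solve 3 (λ a b c → a :* (b :* c) := c :* (a :* b)) refl (N t) (N z) (N θ) ⟩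
    N θ * (N t * N z)      ≈⟨ *-congˡ (*-congˡ (N∘fr≈N z)) ⟨
    N θ * (N t * N (fr z)) ≈⟨ *-congˡ (N-homo-* t (fr z)) ⟨
    N θ * N (t * fr z)     ≈⟨ *-congˡ (N-cong y₂≈) ⟨
    N θ * N y₂             ∎

  FigCondition : Set ℓ
  FigCondition = p₃ * fr p₃ ≈ p₁ * fr p₂ × N p₃ ≉ N p₂

  module _ (p₃≉0 : p₃ ≉ 0#) where

    A≈0∧B≈0⇒InSubplane : ∀ {x} → x ≉ 0# → A x ≈ 0# → B x ≈ 0# → InSubplane P
    A≈0∧B≈0⇒InSubplane {x} x≉0 Ax≈0 Bx≈0 = x , x≉0 , t , *-≉0 p₃≉0 (x⁻¹≉0 fr²x≉0) , p₁≈ , p₂≈ , p₃≈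
      where
      fr²x≉0 = fr-≉0 (fr-≉0 x≉0)
      t = p₃ * (fr (fr x)) ⁻¹
      divide : ∀ {a b} → a * fr (fr x) ≈ p₃ * b → a ≈ t * b
      divide {a} {b} eq = trans (x*y≈z⇒x≈z*y⁻¹ fr²x≉0 eq)
                                (solve 3 (λ p b i → (p :* b) :* i := (p :* i) :* b) refl p₃ b (fr (fr x) ⁻¹))
      p₁≈ : p₁ ≈ t * x
      p₁≈ = divide (sym (x∙y⁻¹≈ε⇒x≈y _ _ Ax≈0))
      p₂≈ : p₂ ≈ t * fr x
      p₂≈ = divide (sym (x∙y⁻¹≈ε⇒x≈y _ _ Bx≈0))
      p₃≈ : p₃ ≈ t * fr (fr x)
      p₃≈ = divide refl

    InFig⇒FigCondition : InFig P → FigCondition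
    InFig⇒FigCondition (inj₁ (P∈mT , _)) = ⊥-elim (p₃≉0 (OnmT⇒≈0 P∈mT))
    InFig⇒FigCondition (inj₂ (((a , b , d) , _) , typeIII , T∈ℓ , P∈ℓ^φ , P∈ℓ^φ²)) = K , Np₃≉Np₂
      where
      d≈0 : d ≈ 0#
      d≈0 = trans (sym (solve 3 (λ a b d → a :* con (+ 0) :+ b :* con (+ 0) :+ d :* con (+ 1) := d) refl a b d)) T∈ℓ
      E₁ : fr a * p₂ + fr b * p₃ ≈ 0#
      E₁ = trans (sym (φL-incidence d≈0)) P∈ℓ^φ
      E₂ : fr (fr b) * p₁ + fr (fr a) * p₃ ≈ 0#
      E₂ = trans (sym (φL²-incidence d≈0)) P∈ℓ^φ²
      Na+Nb≉0 : N a + N b ≉ 0#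
      Na+Nb≉0 = typeIII ∘ trans (det-φL-orbit d≈0)
      a≉0 : a ≉ 0#
      a≉0 a≈0 = Na+Nb≉0 (trans (+-cong (N-≈0 a≈0) (N-≈0 b≈0)) (+-identityˡ 0#))
        where
        b≈0 : b ≈ 0#
        b≈0 = fr-injective (trans (x*y≈0⇒x≈0 p₃≉0 (trans (sym (+-identityˡ _))
                (trans (+-congʳ (sym (trans (*-congʳ (fr-≈0 a≈0)) (zeroˡ p₂)))) E₁))) (sym fr-0))
      K : p₃ * fr p₃ ≈ p₁ * fr p₂
      K = x∙y⁻¹≈ε⇒x≈y _ _ (x*y≈0⇒y≈0 (fr-≉0 (fr-≉0 a≉0)) (begin
        fr (fr a) * (p₃ * fr p₃ - p₁ * fr p₂)
          ≈⟨ solve 6 (λ a₂ b₂ p₁ p₃ p₂₁ p₃₁ →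
               a₂ :* (p₃ :* p₃₁ :- p₁ :* p₂₁) := p₃₁ :* (b₂ :* p₁ :+ a₂ :* p₃) :- p₁ :* (a₂ :* p₂₁ :+ b₂ :* p₃₁)) refl
               (fr (fr a)) (fr (fr b)) p₁ p₃ (fr p₂) (fr p₃) ⟩
        fr p₃ * (fr (fr b) * p₁ + fr (fr a) * p₃) - p₁ * (fr (fr a) * fr p₂ + fr (fr b) * fr p₃)
          ≈⟨ +-cong (*-congˡ E₂) (-‿cong (*-congˡ frE₁)) ⟩
        fr p₃ * 0# - p₁ * 0#
          ≈⟨ solve 2 (λ a b → a :* con (+ 0) :- b :* con (+ 0) := con (+ 0)) refl (fr p₃) p₁ ⟩
        0# ∎))
        where
        frE₁ : fr (fr a) * fr p₂ + fr (fr b) * fr p₃ ≈ 0#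
        frE₁ = trans (sym (trans (fr-homo-+ _ _) (+-cong (fr-homo-* _ _) (fr-homo-* _ _)))) (fr-≈0 E₁)
      Np₃≉Np₂ : N p₃ ≉ N p₂
      Np₃≉Np₂ Np₃≈Np₂ = *-≉0 (N-≉0 p₃≉0) Na+Nb≉0 (begin
        N p₃ * (N a + N b)                ≈⟨ solve 3 (λ n a b → n :* (a :+ b) := a :* n :+ b :* n) refl (N p₃) (N a) (N b) ⟩
        N a * N p₃ + N b * N p₃           ≈⟨ +-congʳ (*-congˡ Np₃≈Np₂) ⟩
        N a * N p₂ + N b * N p₃           ≈⟨ +-cong (*-congʳ (N∘fr≈N a)) (*-congʳ (N∘fr≈N b)) ⟨
        N (fr a) * N p₂ + N (fr b) * N p₃ ≈⟨ +-cong (N-homo-* _ _) (N-homo-* _ _) ⟨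
        N (fr a * p₂) + N (fr b * p₃)     ≈⟨ +-congʳ (trans (N-cong (+-inverseˡ-unique _ _ E₁)) (N-neg _)) ⟩
        - N (fr b * p₃) + N (fr b * p₃)   ≈⟨ -‿inverseˡ _ ⟩
        0#                                ∎)

    FigCondition⇒InFig : FigCondition → InFig P
    FigCondition⇒InFig (K , Np₃≉Np₂) = inj₂ ((line , line≢0) , typeIII , T∈line , P∈line^φ , P∈line^φ²)
      where
      a b : Carrier
      a = fr (fr p₃)
      b = - fr (fr p₂)
      line : Triple
      line = (a , b , 0#)
      line≢0 : NonZeroTriple line
      line≢0 (a≈0 , _) = fr-≉0 (fr-≉0 p₃≉0) a≈0
      fra≈p₃ : fr a ≈ p₃
      fra≈p₃ = fr³≈id p₃
      frb≈-p₂ : fr b ≈ - p₂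
      frb≈-p₂ = trans (fr-neg _) (-‿cong (fr³≈id p₂))
      typeIII : TypeIIILine line
      typeIII det≈0 = Np₃≉Np₂ (x∙y⁻¹≈ε⇒x≈y _ _ (begin
        N p₃ - N p₂           ≈⟨ +-cong (trans (N∘fr≈N _) (N∘fr≈N p₃)) (-‿cong (trans (N∘fr≈N _) (N∘fr≈N p₂))) ⟨
        N a - N (fr (fr p₂))  ≈⟨ +-congˡ (N-neg _) ⟨
        N a + N b             ≈⟨ det-φL-orbit refl ⟨
        det line (φL line) (φL (φL line)) ≈⟨ det≈0 ⟩
        0#                    ∎))
      T∈line : Inc T line
      T∈line = solve 2 (λ a b → a :* con (+ 0) :+ b :* con (+ 0) :+ con (+ 0) :* con (+ 1) := con (+ 0)) refl a b
      P∈line^φ : Inc P (φL line)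
      P∈line^φ = begin
        fr 0# * p₁ + fr a * p₂ + fr b * p₃  ≈⟨ φL-incidence refl ⟩
        fr a * p₂ + fr b * p₃               ≈⟨ +-cong (*-congʳ fra≈p₃) (*-congʳ frb≈-p₂) ⟩
        p₃ * p₂ + - p₂ * p₃                 ≈⟨ solve 2 (λ p₂ p₃ → p₃ :* p₂ :+ (:- p₂) :* p₃ := con (+ 0)) refl p₂ p₃ ⟩
        0#                                  ∎
      P∈line^φ² : Inc P (φL (φL line))
      P∈line^φ² = begin
        fr (fr b) * p₁ + fr (fr 0#) * p₂ + fr (fr a) * p₃ ≈⟨ φL²-incidence refl ⟩
        fr (fr b) * p₁ + fr (fr a) * p₃                   ≈⟨ +-cong (*-congʳ (trans (fr-cong frb≈-p₂) (fr-neg p₂))) (*-congʳ (fr-cong fra≈p₃)) ⟩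
        - fr p₂ * p₁ + fr p₃ * p₃                         ≈⟨ solve 4 (λ p₁ p₃ p₂₁ p₃₁ → (:- p₂₁) :* p₁ :+ p₃₁ :* p₃ := p₃ :* p₃₁ :- p₁ :* p₂₁) refl p₁ p₃ (fr p₂) (fr p₃) ⟩
        p₃ * fr p₃ - p₁ * fr p₂                           ≈⟨ x≈y⇒x∙y⁻¹≈ε K ⟩
        0#                                                ∎

    module FromFigCondition (P∉subplane : ¬ InSubplane P) (K : p₃ * fr p₃ ≈ p₁ * fr p₂) where

      p₂≉0 : p₂ ≉ 0#
      p₂≉0 p₂≈0 = *-≉0 p₃≉0 (fr-≉0 p₃≉0) (trans K (trans (*-congˡ (fr-≈0 p₂≈0)) (zeroʳ p₁)))

      θ : Carrier
      θ = - p₃ * (fr p₂) ⁻¹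

      θ≉0 : θ ≉ 0#
      θ≉0 = *-≉0 (λ -p₃≈0 → p₃≉0 (-‿injective (trans -p₃≈0 (sym -0#≈0#)))) (x⁻¹≉0 (fr-≉0 p₂≉0))

      A≈θ*fr∘B : ∀ x → A x ≈ θ * fr (B x)
      A≈θ*fr∘B x = begin
        A x
          ≈⟨ x*y≈z⇒x≈z*y⁻¹ (fr-≉0 p₂≉0) (+-inverseˡ-unique _ _ A*frp₂+p₃*fr∘B≈0) ⟩
        - (p₃ * fr (B x)) * (fr p₂) ⁻¹
          ≈⟨ solve 3 (λ a b c → (:- (a :* b)) :* c := ((:- a) :* c) :* b) refl p₃ (fr (B x)) ((fr p₂) ⁻¹) ⟩
        θ * fr (B x)
          ∎
        where
        A*frp₂+p₃*fr∘B≈0 : A x * fr p₂ + p₃ * fr (B x) ≈ 0#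
        A*frp₂+p₃*fr∘B≈0 = begin
          A x * fr p₂ + p₃ * fr (B x)
            ≈⟨ +-congˡ (*-congˡ (fr∘B x)) ⟩
          (p₃ * x - p₁ * fr (fr x)) * fr p₂ + p₃ * (fr p₃ * fr (fr x) - fr p₂ * x)
            ≈⟨ solve 6 (λ p₁ p₃ x x₂ p₂₁ p₃₁ → (p₃ :* x :- p₁ :* x₂) :* p₂₁ :+ p₃ :* (p₃₁ :* x₂ :- p₂₁ :* x)
                                               := x₂ :* (p₃ :* p₃₁ :- p₁ :* p₂₁)) refl p₁ p₃ x (fr (fr x)) (fr p₂) (fr p₃) ⟩
          fr (fr x) * (p₃ * fr p₃ - p₁ * fr p₂)
            ≈⟨ *-congˡ (x≈y⇒x∙y⁻¹≈ε K) ⟩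
          fr (fr x) * 0#
            ≈⟨ zeroʳ _ ⟩
          0# ∎

      B≉0 : ∀ {x} → x ≉ 0# → B x ≉ 0#
      B≉0 x≉0 Bx≈0 = P∉subplane (A≈0∧B≈0⇒InSubplane x≉0 (trans (A≈θ*fr∘B _) (trans (*-congˡ (fr-≈0 Bx≈0)) (zeroʳ θ))) Bx≈0)

      ProjSet⊆Sθ : ∀ (Y : Point) → ProjSet P (proj₁ Y) → Sθ θ (proj₁ Y)
      ProjSet⊆Sθ ((y₁ , y₂ , y₃) , Y≢0) (Y∈mT , x , x≉0 , det≈0) =
        (B x) ⁻¹ , x⁻¹≉0 (B≉0 x≉0) , t , *-≉0 y₂≉0 (fr-≉0 (B≉0 x≉0)) , y₁≈ , y₂≈ , trans y₃≈0 (sym (zeroʳ t))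
        where
        y₃≈0 = OnmT⇒≈0 Y∈mT
        y₂A≈y₁B : y₂ * A x ≈ y₁ * B x
        y₂A≈y₁B = x∙y⁻¹≈ε⇒x≈y _ _ (trans (sym (det-projection x y₃≈0)) det≈0)
        y₂≉0 : y₂ ≉ 0#
        y₂≉0 y₂≈0 = Y≢0 (x*y≈0⇒x≈0 (B≉0 x≉0) (trans (sym y₂A≈y₁B) (trans (*-congʳ y₂≈0) (zeroˡ _))) , y₂≈0 , y₃≈0)
        t = y₂ * fr (B x)
        y₁≈ : y₁ ≈ t * ((B x) ⁻¹ * θ)
        y₁≈ = begin
          y₁
            ≈⟨ x*y≈z⇒x≈z*y⁻¹ (B≉0 x≉0) (sym y₂A≈y₁B) ⟩
          (y₂ * A x) * (B x) ⁻¹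
            ≈⟨ *-congʳ (*-congˡ (A≈θ*fr∘B x)) ⟩
          (y₂ * (θ * fr (B x))) * (B x) ⁻¹
            ≈⟨ solve 4 (λ a b c d → (a :* (b :* c)) :* d := (a :* c) :* (d :* b)) refl y₂ θ (fr (B x)) ((B x) ⁻¹) ⟩
          t * ((B x) ⁻¹ * θ)
            ∎
        y₂≈ : y₂ ≈ t * fr ((B x) ⁻¹)
        y₂≈ = sym (begin
          (y₂ * fr (B x)) * fr ((B x) ⁻¹)   ≈⟨ *-congˡ (fr-⁻¹ (B≉0 x≉0)) ⟩
          (y₂ * fr (B x)) * (fr (B x)) ⁻¹   ≈⟨ *-assoc _ _ _ ⟩
          y₂ * (fr (B x) * (fr (B x)) ⁻¹)   ≈⟨ *-congˡ (x*x⁻¹≈1 (fr-≉0 (B≉0 x≉0))) ⟩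
          y₂ * 1#                           ≈⟨ *-identityʳ y₂ ⟩
          y₂                                ∎)

      Sθ⊆ProjSet : N p₃ ≉ N p₂ → ∀ (Y : Point) → Sθ θ (proj₁ Y) → ProjSet P (proj₁ Y)
      Sθ⊆ProjSet Np₃≉Np₂ ((y₁ , y₂ , y₃) , _) (z , z≉0 , t , _ , y₁≈ , y₂≈ , y₃≈) =
        ≈0⇒OnmT y₃≈0 , x , x≉0 , (begin
          det P (x , fr x , fr (fr x)) (y₁ , y₂ , y₃)
            ≈⟨ det-projection x y₃≈0 ⟩
          y₂ * A x - y₁ * B x
            ≈⟨ +-cong (*-cong y₂≈ Ax≈) (-‿cong (*-cong y₁≈ Bx≈z⁻¹)) ⟩
          (t * fr z) * (θ * (fr z) ⁻¹) - (t * (z * θ)) * z ⁻¹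
            ≈⟨ solve 6 (λ t z₁ θ i₁ z i → (t :* z₁) :* (θ :* i₁) :- (t :* (z :* θ)) :* i
                                          := (t :* θ) :* (z₁ :* i₁ :- z :* i))
                       refl t (fr z) θ ((fr z) ⁻¹) z (z ⁻¹) ⟩
          (t * θ) * (fr z * (fr z) ⁻¹ - z * z ⁻¹)
            ≈⟨ *-congˡ (x≈y⇒x∙y⁻¹≈ε (trans (x*x⁻¹≈1 (fr-≉0 z≉0)) (sym (x*x⁻¹≈1 z≉0)))) ⟩
          (t * θ) * 0#
            ≈⟨ zeroʳ _ ⟩
          0#
            ∎)
        where
        y₃≈0 = trans y₃≈ (zeroʳ t)
        x = proj₁ (B-surjective Np₃≉Np₂ (z ⁻¹))
        Bx≈z⁻¹ : B x ≈ z ⁻¹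
        Bx≈z⁻¹ = proj₂ (B-surjective Np₃≉Np₂ (z ⁻¹))
        x≉0 : x ≉ 0#
        x≉0 x≈0 = x⁻¹≉0 z≉0 (trans (sym Bx≈z⁻¹) (B-≈0 x≈0))
        Ax≈ : A x ≈ θ * (fr z) ⁻¹
        Ax≈ = trans (A≈θ*fr∘B x) (*-congˡ (trans (fr-cong Bx≈z⁻¹) (fr-⁻¹ z≉0)))

    FigCondition⇒IsTsls : ¬ InSubplane P → FigCondition → IsTsls (ProjSet P)
    FigCondition⇒IsTsls P∉subplane (K , Np₃≉Np₂) = θ , θ≉0 , λ Y → ProjSet⊆Sθ Y , Sθ⊆ProjSet Np₃≉Np₂ Y
      where open FromFigCondition P∉subplane K

    -- Both norms expand into the same seven q-monomials x^i (x^q)^j (x^{q²})^k with digits i, j, k ≤ 2,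
    -- whose exponents i + q j + q² k are distinct and below q³ once q ≥ 3.
    norm-identity⇒coefficients : 3 ℕ.≤ q → ∀ c₀ → (∀ x → N (A x) ≈ c₀ * N (B x)) →
                                 p₃ * fr p₁ + c₀ * (p₂ * fr p₂) ≈ 0# × fr p₁ * fr (fr p₁) + c₀ * (fr p₂ * fr (fr p₃)) ≈ 0#
    norm-identity⇒coefficients 3≤q c₀ N∘A≈c₀*N∘B = I₁ , I₂
      where
      open import Algebra.Properties.Semiring.Sum semiring using (sum; sum-cong-≋; ∑-distrib-+; *-distribˡ-sum)
      d : Fin 7 → Digits
      d 0F = 1 , 1 , 1
      d 1F = 1 , 2 , 0
      d 2F = 2 , 0 , 1
      d 3F = 2 , 1 , 0
      d 4F = 0 , 1 , 2
      d 5F = 0 , 2 , 1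
      d 6F = 1 , 0 , 2
      position : Digits → Fin 7
      position (1 , 1 , _) = 0F
      position (1 , 2 , _) = 1F
      position (2 , 0 , _) = 2F
      position (2 , 1 , _) = 3F
      position (0 , 1 , _) = 4F
      position (0 , 2 , _) = 5F
      position _           = 6F
      d-injective : Injective _≡_ _≡_ d
      d-injective = inverseʳ⇒injective d (strictlyInverseʳ⇒inverseʳ {f⁻¹ = position} d λ
        { 0F → ≡.refl ; 1F → ≡.refl ; 2F → ≡.refl ; 3F → ≡.refl ; 4F → ≡.refl ; 5F → ≡.refl ; 6F → ≡.refl })
      0<q : 0 ℕ.< q
      0<q = ℕ.≤-trans (ℕ.s≤s ℕ.z≤n) 3≤q
      1<q : 1 ℕ.< q
      1<q = ℕ.≤-trans (ℕ.s≤s (ℕ.s≤s ℕ.z≤n)) 3≤q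
      d<q : ∀ i → DigitsBelow q (d i)
      d<q 0F = 1<q , 1<q , 1<q
      d<q 1F = 1<q , 3≤q , 0<q
      d<q 2F = 3≤q , 0<q , 1<q
      d<q 3F = 3≤q , 1<q , 0<q
      d<q 4F = 0<q , 1<q , 3≤q
      d<q 5F = 0<q , 3≤q , 1<q
      d<q 6F = 1<q , 0<q , 3≤q
      κA κB : Fin 7 → Carrier
      κA 0F = p₃ * fr p₃ * fr (fr p₃) - p₁ * fr p₁ * fr (fr p₁)
      κA 1F = - (p₃ * fr p₃ * fr (fr p₁))
      κA 2F = - (p₃ * fr p₁ * fr (fr p₃))
      κA 3F = p₃ * fr p₁ * fr (fr p₁)
      κA 4F = - (p₁ * fr p₃ * fr (fr p₃))
      κA 5F = p₁ * fr p₃ * fr (fr p₁)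
      κA 6F = p₁ * fr p₁ * fr (fr p₃)
      κB 0F = p₃ * fr p₃ * fr (fr p₃) - p₂ * fr p₂ * fr (fr p₂)
      κB 1F = p₃ * fr p₂ * fr (fr p₂)
      κB 2F = p₂ * fr p₂ * fr (fr p₃)
      κB 3F = - (p₃ * fr p₂ * fr (fr p₃))
      κB 4F = p₂ * fr p₃ * fr (fr p₂)
      κB 5F = - (p₃ * fr p₃ * fr (fr p₂))
      κB 6F = - (p₂ * fr p₃ * fr (fr p₃))
      N∘A-expansion : ∀ x → N (A x) ≈ sum (λ i → κA i * qMonomial (d i) x)
      N∘A-expansion x = begin
        A x * (fr (A x) * fr (fr (A x)))
          ≈⟨ *-congˡ (*-congˡ (trans (fr-cong (fr∘A x)) (trans (fr-homo-sub _ _) (+-congʳ (fr-homo-* _ _))))) ⟩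
        A x * (fr (A x) * (fr (fr p₃) * fr (fr x) - fr (fr p₁ * x)))
          ≈⟨ *-congˡ (*-cong (fr∘A x) (+-congˡ (-‿cong (fr-homo-* _ _)))) ⟩
        (p₃ * x - p₁ * fr (fr x)) * ((fr p₃ * fr x - fr p₁ * x) * (fr (fr p₃) * fr (fr x) - fr (fr p₁) * fr x))
          ≈⟨ solve 9 (λ a c a′ c′ a″ c″ x₀ x₁ x₂ →
               (c :* x₀ :- a :* x₂) :* ((c′ :* x₁ :- a′ :* x₀) :* (c″ :* x₂ :- a″ :* x₁))
               := (c :* c′ :* c″ :- a :* a′ :* a″) :* (x₀ :^ 1 :* (x₁ :^ 1 :* x₂ :^ 1))
                  :+ ((:- (c :* c′ :* a″)) :* (x₀ :^ 1 :* (x₁ :^ 2 :* x₂ :^ 0))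
                  :+ ((:- (c :* a′ :* c″)) :* (x₀ :^ 2 :* (x₁ :^ 0 :* x₂ :^ 1))
                  :+ ((c :* a′ :* a″) :* (x₀ :^ 2 :* (x₁ :^ 1 :* x₂ :^ 0))
                  :+ ((:- (a :* c′ :* c″)) :* (x₀ :^ 0 :* (x₁ :^ 1 :* x₂ :^ 2))
                  :+ ((a :* c′ :* a″) :* (x₀ :^ 0 :* (x₁ :^ 2 :* x₂ :^ 1))
                  :+ ((a :* a′ :* c″) :* (x₀ :^ 1 :* (x₁ :^ 0 :* x₂ :^ 2))
                  :+ con (+ 0))))))))
               refl p₁ p₃ (fr p₁) (fr p₃) (fr (fr p₁)) (fr (fr p₃)) x (fr x) (fr (fr x)) ⟩
        sum (λ i → κA i * qMonomial (d i) x) ∎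
      N∘B-expansion : ∀ x → N (B x) ≈ sum (λ i → κB i * qMonomial (d i) x)
      N∘B-expansion x = begin
        B x * (fr (B x) * fr (fr (B x)))
          ≈⟨ *-congˡ (*-congˡ (trans (fr-cong (fr∘B x)) (fr-homo-sub _ _))) ⟩
        B x * (fr (B x) * (fr (fr p₃ * fr (fr x)) - fr (fr p₂ * x)))
          ≈⟨ *-congˡ (*-cong (fr∘B x) (+-cong (trans (fr-homo-* _ _) (*-congˡ (fr³≈id x))) (-‿cong (fr-homo-* _ _)))) ⟩
        (p₃ * fr x - p₂ * fr (fr x)) * ((fr p₃ * fr (fr x) - fr p₂ * x) * (fr (fr p₃) * x - fr (fr p₂) * fr x))
          ≈⟨ solve 9 (λ b c b′ c′ b″ c″ x₀ x₁ x₂ →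
               (c :* x₁ :- b :* x₂) :* ((c′ :* x₂ :- b′ :* x₀) :* (c″ :* x₀ :- b″ :* x₁))
               := (c :* c′ :* c″ :- b :* b′ :* b″) :* (x₀ :^ 1 :* (x₁ :^ 1 :* x₂ :^ 1))
                  :+ ((c :* b′ :* b″) :* (x₀ :^ 1 :* (x₁ :^ 2 :* x₂ :^ 0))
                  :+ ((b :* b′ :* c″) :* (x₀ :^ 2 :* (x₁ :^ 0 :* x₂ :^ 1))
                  :+ ((:- (c :* b′ :* c″)) :* (x₀ :^ 2 :* (x₁ :^ 1 :* x₂ :^ 0))
                  :+ ((b :* c′ :* b″) :* (x₀ :^ 0 :* (x₁ :^ 1 :* x₂ :^ 2))
                  :+ ((:- (c :* c′ :* b″)) :* (x₀ :^ 0 :* (x₁ :^ 2 :* x₂ :^ 1))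
                  :+ ((:- (b :* c′ :* c″)) :* (x₀ :^ 1 :* (x₁ :^ 0 :* x₂ :^ 2))
                  :+ con (+ 0))))))))
               refl p₂ p₃ (fr p₂) (fr p₃) (fr (fr p₂)) (fr (fr p₃)) x (fr x) (fr (fr x)) ⟩
        sum (λ i → κB i * qMonomial (d i) x) ∎
      κ≈0 : ∀ i → κA i - c₀ * κB i ≈ 0#
      κ≈0 = qMonomials-independent (λ i → κA i - c₀ * κB i) d d-injective d<q λ x → begin
        sum (λ i → (κA i - c₀ * κB i) * qMonomial (d i) x)
          ≈⟨ sum-cong-≋ (λ i → solve 4 (λ a b c m → (a :- c :* b) :* m := a :* m :+ (:- c) :* (b :* m)) refl
                                        (κA i) (κB i) c₀ (qMonomial (d i) x)) ⟩
        sum (λ i → κA i * qMonomial (d i) x + - c₀ * (κB i * qMonomial (d i) x))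
          ≈⟨ ∑-distrib-+ (λ i → κA i * qMonomial (d i) x) (λ i → - c₀ * (κB i * qMonomial (d i) x)) ⟩
        sum (λ i → κA i * qMonomial (d i) x) + sum (λ i → - c₀ * (κB i * qMonomial (d i) x))
          ≈⟨ +-cong (N∘A-expansion x) (*-distribˡ-sum (- c₀) (λ i → κB i * qMonomial (d i) x)) ⟨
        N (A x) + - c₀ * sum (λ i → κB i * qMonomial (d i) x)
          ≈⟨ +-cong (N∘A≈c₀*N∘B x) (*-congˡ (sym (N∘B-expansion x))) ⟩
        c₀ * N (B x) + - c₀ * N (B x)
          ≈⟨ solve 2 (λ c n → c :* n :+ (:- c) :* n := con (+ 0)) refl c₀ (N (B x)) ⟩
        0# ∎
      I₁ : p₃ * fr p₁ + c₀ * (p₂ * fr p₂) ≈ 0#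
      I₁ = x*y≈0⇒y≈0 (fr-≉0 (fr-≉0 p₃≉0)) (begin
        fr (fr p₃) * (p₃ * fr p₁ + c₀ * (p₂ * fr p₂))
          ≈⟨ solve 6 (λ p₃₂ p₃ p₁₁ c p₂ p₂₁ → p₃₂ :* (p₃ :* p₁₁ :+ c :* (p₂ :* p₂₁))
                                            := :- ((:- (p₃ :* p₁₁ :* p₃₂)) :- c :* (p₂ :* p₂₁ :* p₃₂))) refl
                                            (fr (fr p₃)) p₃ (fr p₁) c₀ p₂ (fr p₂) ⟩
        - (κA 2F - c₀ * κB 2F)   ≈⟨ -‿cong (κ≈0 2F) ⟩
        - 0#                     ≈⟨ -0#≈0# ⟩
        0#                       ∎)
      I₂ : fr p₁ * fr (fr p₁) + c₀ * (fr p₂ * fr (fr p₃)) ≈ 0#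
      I₂ = x*y≈0⇒y≈0 p₃≉0 (begin
        p₃ * (fr p₁ * fr (fr p₁) + c₀ * (fr p₂ * fr (fr p₃)))
          ≈⟨ solve 6 (λ p₃ p₁₁ p₁₂ c p₂₁ p₃₂ → p₃ :* (p₁₁ :* p₁₂ :+ c :* (p₂₁ :* p₃₂))
                                            := p₃ :* p₁₁ :* p₁₂ :- c :* (:- (p₃ :* p₂₁ :* p₃₂))) refl
                                            p₃ (fr p₁) (fr (fr p₁)) c₀ (fr p₂) (fr (fr p₃)) ⟩
        κA 3F - c₀ * κB 3F       ≈⟨ κ≈0 3F ⟩
        0#                       ∎)

    Np₃≈Np₂⇒B-root : N p₃ ≈ N p₂ → ∃ λ x → x ≉ 0# × B x ≈ 0#
    Np₃≈Np₂⇒B-root Np₃≈Np₂ = root (hilbert90 p₃≉0 Np₃≈Np₂)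
      where
      root : (∃ λ y → y ≉ 0# × p₃ * y ≈ p₂ * fr y) → ∃ λ x → x ≉ 0# × B x ≈ 0#
      root (y , y≉0 , p₃y≈p₂fry) = fr (fr y) , fr-≉0 (fr-≉0 y≉0) , (begin
        p₃ * fr (fr (fr y)) - p₂ * fr (fr (fr (fr y)))  ≈⟨ +-cong (*-congˡ (fr³≈id y)) (-‿cong (*-congˡ (fr-cong (fr³≈id y)))) ⟩
        p₃ * y - p₂ * fr y                              ≈⟨ x≈y⇒x∙y⁻¹≈ε p₃y≈p₂fry ⟩
        0#                                              ∎)

    Np₁≈Np₃⇒A-root : p₁ ≉ 0# → N p₁ ≈ N p₃ → ∃ λ x → x ≉ 0# × A x ≈ 0#
    Np₁≈Np₃⇒A-root p₁≉0 Np₁≈Np₃ = root (hilbert90 p₁≉0 Np₁≈Np₃)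
      where
      root : (∃ λ y → y ≉ 0# × p₁ * y ≈ p₃ * fr y) → ∃ λ x → x ≉ 0# × A x ≈ 0#
      root (y , y≉0 , p₁y≈p₃fry) = fr y , fr-≉0 y≉0 , (begin
        p₃ * fr y - p₁ * fr (fr (fr y))   ≈⟨ +-congˡ (-‿cong (*-congˡ (fr³≈id y))) ⟩
        p₃ * fr y - p₁ * y                ≈⟨ x≈y⇒x∙y⁻¹≈ε (sym p₁y≈p₃fry) ⟩
        0#                                ∎)

    norm-coefficients⇒K : ∀ {c₀} → p₁ ≉ 0# → p₃ * fr p₁ + c₀ * (p₂ * fr p₂) ≈ 0# →
                          fr p₁ * fr (fr p₁) + c₀ * (fr p₂ * fr (fr p₃)) ≈ 0# → p₃ * fr p₃ ≈ p₁ * fr p₂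
    norm-coefficients⇒K {c₀} p₁≉0 I₁ I₂ = begin
      p₃ * fr p₃                ≈⟨ *-comm _ _ ⟩
      fr p₃ * p₃                ≈⟨ *-congˡ (fr³≈id p₃) ⟨
      fr p₃ * fr (fr (fr p₃))   ≈⟨ fr-homo-* _ _ ⟨
      fr (p₃ * fr (fr p₃))      ≈⟨ fr-cong p₂fr²p₁≈p₃fr²p₃ ⟨
      fr (p₂ * fr (fr p₁))      ≈⟨ fr-homo-* _ _ ⟩
      fr p₂ * fr (fr (fr p₁))   ≈⟨ *-congˡ (fr³≈id p₁) ⟩
      fr p₂ * p₁                ≈⟨ *-comm _ _ ⟩
      p₁ * fr p₂                ∎
      where
      p₂fr²p₁≈p₃fr²p₃ : p₂ * fr (fr p₁) ≈ p₃ * fr (fr p₃)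
      p₂fr²p₁≈p₃fr²p₃ = x∙y⁻¹≈ε⇒x≈y _ _ (x*y≈0⇒y≈0 (fr-≉0 p₁≉0) (begin
        fr p₁ * (p₂ * fr (fr p₁) - p₃ * fr (fr p₃))
          ≈⟨ solve 7 (λ p₁₁ p₂ p₁₂ p₃ p₃₂ c p₂₁ →
               p₁₁ :* (p₂ :* p₁₂ :- p₃ :* p₃₂) := p₂ :* (p₁₁ :* p₁₂ :+ c :* (p₂₁ :* p₃₂)) :- p₃₂ :* (p₃ :* p₁₁ :+ c :* (p₂ :* p₂₁))) refl
               (fr p₁) p₂ (fr (fr p₁)) p₃ (fr (fr p₃)) c₀ (fr p₂) ⟩
        p₂ * (fr p₁ * fr (fr p₁) + c₀ * (fr p₂ * fr (fr p₃))) - fr (fr p₃) * (p₃ * fr p₁ + c₀ * (p₂ * fr p₂))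
          ≈⟨ +-cong (*-congˡ I₂) (-‿cong (*-congˡ I₁)) ⟩
        p₂ * 0# - fr (fr p₃) * 0#
          ≈⟨ solve 2 (λ a b → a :* con (+ 0) :- b :* con (+ 0) := con (+ 0)) refl p₂ (fr (fr p₃)) ⟩
        0# ∎))

    module FromTsls (P∉subplane : ¬ InSubplane P) (P≁T : ¬ (P ∼ T)) {θ} (θ≉0 : θ ≉ 0#)
                    (ProjSet⊆Sθ : ∀ (Y : Point) → ProjSet P (proj₁ Y) → Sθ θ (proj₁ Y)) where

      projection∈Sθ : ∀ {x} → x ≉ 0# → Sθ θ (A x , B x , 0#)
      projection∈Sθ {x} x≉0 = ProjSet⊆Sθ ((A x , B x , 0#) , AB≢0) (≈0⇒OnmT refl , x , x≉0 , det≈0)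
        where
        AB≢0 : NonZeroTriple (A x , B x , 0#)
        AB≢0 (Ax≈0 , Bx≈0 , _) = P∉subplane (A≈0∧B≈0⇒InSubplane x≉0 Ax≈0 Bx≈0)
        det≈0 = trans (det-projection x refl) (solve 2 (λ a b → b :* a :- a :* b := con (+ 0)) refl (A x) (B x))

      A≉0 : ∀ {x} → x ≉ 0# → A x ≉ 0#
      A≉0 = proj₁ ∘ Sθ⇒≉0 θ≉0 ∘ projection∈Sθ

      B≉0 : ∀ {x} → x ≉ 0# → B x ≉ 0#
      B≉0 = proj₂ ∘ Sθ⇒≉0 θ≉0 ∘ projection∈Sθ

      N∘A≈Nθ*N∘B : ∀ x → N (A x) ≈ N θ * N (B x)
      N∘A≈Nθ*N∘B x with x ≟ 0#
      ... | yes x≈0 = trans (N-≈0 (A-≈0 x≈0)) (sym (trans (*-congˡ (N-≈0 (B-≈0 x≈0))) (zeroʳ _)))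
      ... | no x≉0  = Sθ⇒N≈ (projection∈Sθ x≉0)

      Np₃≉Np₂ : N p₃ ≉ N p₂
      Np₃≉Np₂ Np₃≈Np₂ = let (x , x≉0 , Bx≈0) = Np₃≈Np₂⇒B-root Np₃≈Np₂ in B≉0 x≉0 Bx≈0

      p₂≈0⇒p₁≉0 : p₂ ≈ 0# → p₁ ≉ 0#
      p₂≈0⇒p₁≉0 p₂≈0 p₁≈0 = P≁T (p₃ , p₃≉0 , trans p₁≈0 (sym (zeroʳ p₃)) , trans p₂≈0 (sym (zeroʳ p₃)) , sym (*-identityʳ p₃))

      Np₁≉Np₃ : p₁ ≉ 0# → N p₁ ≉ N p₃
      Np₁≉Np₃ p₁≉0 Np₁≈Np₃ = let (x , x≉0 , Ax≈0) = Np₁≈Np₃⇒A-root p₁≉0 Np₁≈Np₃ in A≉0 x≉0 Ax≈0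

      q≢2 : q ≢ 2
      q≢2 q≡2 with p₂ ≟ 0#
      ... | yes p₂≈0 = Np₁≉Np₃ (p₂≈0⇒p₁≉0 p₂≈0) (trans (q≡2⇒N≈1 q≡2 (p₂≈0⇒p₁≉0 p₂≈0)) (sym (q≡2⇒N≈1 q≡2 p₃≉0)))
      ... | no p₂≉0  = Np₃≉Np₂ (trans (q≡2⇒N≈1 q≡2 p₃≉0) (sym (q≡2⇒N≈1 q≡2 p₂≉0)))

      K : p₃ * fr p₃ ≈ p₁ * fr p₂
      K = norm-coefficients⇒K p₁≉0 I₁ I₂
        where
        coefficients = norm-identity⇒coefficients (ℕ.≤∧≢⇒< 2≤q (q≢2 ∘ ≡.sym)) (N θ) N∘A≈Nθ*N∘B
        I₁ : p₃ * fr p₁ + N θ * (p₂ * fr p₂) ≈ 0#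
        I₁ = proj₁ coefficients
        I₂ : fr p₁ * fr (fr p₁) + N θ * (fr p₂ * fr (fr p₃)) ≈ 0#
        I₂ = proj₂ coefficients
        p₁≉0 : p₁ ≉ 0#
        p₁≉0 p₁≈0 with p₂ ≟ 0#
        ... | yes p₂≈0 = p₂≈0⇒p₁≉0 p₂≈0 p₁≈0
        ... | no p₂≉0  = *-≉0 (N-≉0 θ≉0) (*-≉0 p₂≉0 (fr-≉0 p₂≉0))
                           (trans (sym (+-identityˡ _)) (trans (+-congʳ (sym (trans (*-congˡ (fr-≈0 p₁≈0)) (zeroʳ p₃)))) I₁))

    IsTsls⇒FigCondition : ¬ InSubplane P → ¬ (P ∼ T) → IsTsls (ProjSet P) → FigCondition
    IsTsls⇒FigCondition P∉subplane P≁T (θ , θ≉0 , ProjSet≡Sθ) = K , Np₃≉Np₂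
      where open FromTsls P∉subplane P≁T θ≉0 (λ Y → proj₁ (ProjSet≡Sθ Y))


open import Data.Nat using (_^_)

theorem8p1 : ∀ {c ℓ} (R : CommutativeRing c ℓ) (q : ℕ) → IsPrimePower q
    → IsFiniteFieldOfOrder R (q ^ 3)
    → (P : Plane.Point R q)
    → ¬ (Plane._∼_ R q (proj₁ P) (Plane.T R q))
    → ¬ (Plane.OnmT R q (proj₁ P))
    → ¬ (Plane.InSubplane R q (proj₁ P))
    → (Plane.InFig R q (proj₁ P) ⇔ Plane.IsTsls R q (Plane.ProjSet R q (proj₁ P)))
theorem8p1 R q isPrimePower isFiniteField ((p₁ , p₂ , p₃) , _) P≁T P∉mT P∉subplane =
  mk⇔ (FigCondition⇒IsTsls p₃≉0 P∉subplane ∘ InFig⇒FigCondition p₃≉0)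
      (FigCondition⇒InFig p₃≉0 ∘ IsTsls⇒FigCondition p₃≉0 P∉subplane P≁T)
  where
  open Projection R q isPrimePower isFiniteField p₁ p₂ p₃
  p₃≉0 = P∉mT ∘ ≈0⇒OnmT
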